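{- Let $G$ be a connected graph with $V_{2,3}(G)\neq\emptyset$. If the stable colouring $\mathcal R^*\sigma$ assigns all vertices of $V_{2,3}(G)$ pairwise distinct colours, then $G$ is CR-determined.
   Context: Colour refinement: for a graph $G$ and colouring $c:V(G)\to\Omega$, $\mathcal R_Gc(v)=(c(v),(d_\omega(v))_{\omega\in\Omega})$ where $d_\omega(v)$ is the number of neighbours of $v$ of colour $\omega$; iterating $\mathcal R_G$ until the induced vertex partition stops changing gives the stable colouring $\mathcal R^*c$. $\sigma$ is the trivial colouring (all vertices the same colour). $G$ is CR-determined if the multiset of colours in $\mathcal R^*\sigma$ distinguishes $G$ from all non-isomorphic graphs, i.e. there is no graph $H$ not isomorphic to $G$ for which colour refinement produces the same multiset of colours. The $2$-core of $G$ is its largest subgraph of minimum degree at least $2$; $V_{2,3}(G)$ is the set of vertices of the $2$-core that have degree at least $3$ in the $2$-core. -}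

module Defs where

open import Data.Nat using (ℕ; zero; suc; _+_; _≤_; _≡ᵇ_)
open import Data.Bool using (Bool; true; false; _∧_; if_then_else_)
open import Data.Fin using (Fin; zero; suc; _↑ˡ_; _↑ʳ_; splitAt)
open import Data.Sum using (inj₁; inj₂)
open import Data.Product using (Σ; ∃; _×_)
open import Function.Bundles using (_↔_; Inverse)
open import Relation.Binary.PropositionalEquality using (_≡_)

record Graph : Set where
  field
    n      : ℕ
    adj    : Fin n → Fin n → Bool
    sym    : ∀ u v → adj u v ≡ adj v u
    irrefl : ∀ v → adj v v ≡ false
open Graph public

count : ∀ {N} → (Fin N → Bool) → ℕ
count {zero}  f = 0
count {suc N} f = (if f zero then 1 else 0) + count (λ i → f (suc i))

allF : ∀ {N} → (Fin N → Bool) → Bool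
allF {zero}  f = true
allF {suc N} f = f zero ∧ allF (λ i → f (suc i))

-- Colour refinement from the trivial colouring σ on a graph given by an
-- adjacency function on Fin N.  eqCol adj k x y = true iff x and y receive
-- the same colour in (R^k σ).  Colours are compared as equivalence classes:
-- R c(x) = R c(y) iff c(x) = c(y) and for every colour ω (represented by a
-- vertex z of that colour; colours not occurring give count 0 on both sides)
-- d_ω(x) = d_ω(y).
eqCol : ∀ {N} → (Fin N → Fin N → Bool) → ℕ → Fin N → Fin N → Bool
eqCol a zero    x y = true
eqCol a (suc k) x y =
  eqCol a k x y ∧
  allF (λ z → count (λ w → a x w ∧ eqCol a k w z)
           ≡ᵇ count (λ w → a y w ∧ eqCol a k w z))

unionAdj : (G H : Graph) → Fin (n G + n H) → Fin (n G + n H) → Bool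
unionAdj G H x y with splitAt (n G) x | splitAt (n G) y
... | inj₁ a | inj₁ b = adj G a b
... | inj₂ a | inj₂ b = adj H a b
... | inj₁ _ | inj₂ _ = false
... | inj₂ _ | inj₁ _ = false

-- Round k of colour refinement (run on the disjoint union, so that colours
-- are comparable) gives G and H the same multiset of colours.
SameMultisetAt : (G H : Graph) → ℕ → Set
SameMultisetAt G H k =
  Σ (Fin (n G) ↔ Fin (n H)) λ π →
    ∀ v → eqCol (unionAdj G H) k (v ↑ˡ n H) (n G ↑ʳ Inverse.to π v) ≡ true

CRIndist : (G H : Graph) → Set
CRIndist G H = ∀ k → SameMultisetAt G H k

Isomorphic : (G H : Graph) → Set
Isomorphic G H =
  Σ (Fin (n G) ↔ Fin (n H)) λ π →
    ∀ u v → adj H (Inverse.to π u) (Inverse.to π v) ≡ adj G u v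

CRDetermined : Graph → Set
CRDetermined G = ∀ (H : Graph) → CRIndist G H → Isomorphic G H

data Reach (G : Graph) (u : Fin (n G)) : Fin (n G) → Set where
  here : Reach G u u
  step : ∀ {v w} → Reach G u v → adj G v w ≡ true → Reach G u w

Connected : Graph → Set
Connected G = ∀ u v → Reach G u v

VSet : Graph → Set
VSet G = Fin (n G) → Bool

degIn : (G : Graph) → VSet G → Fin (n G) → ℕ
degIn G S v = count (λ w → S w ∧ adj G v w)

MinDeg2 : (G : Graph) → VSet G → Set
MinDeg2 G S = ∀ v → S v ≡ true → 2 ≤ degIn G S v

IsTwoCore : (G : Graph) → VSet G → Set
IsTwoCore G S = MinDeg2 G S × (∀ T → MinDeg2 G T → ∀ v → T v ≡ true → S v ≡ true)

InV23 : (G : Graph) → VSet G → Fin (n G) → Set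
InV23 G S v = (S v ≡ true) × (3 ≤ degIn G S v)

Stable : Graph → ℕ → Set
Stable G k = ∀ u v → eqCol (adj G) k u v ≡ true → eqCol (adj G) (suc k) u v ≡ true

-- Let H be indistinguishable from G and fix a stable round of colour refinement on the disjoint
-- union G + H.  Its colour classes form an equitable partition, and every class has as many
-- vertices in G as in H.  The 2-core S of G is a union of classes, hence so is V₂,₃, and by
-- hypothesis each vertex of V₂,₃ is alone in its class.  Since G is connected and V₂,₃ ≠ ∅, the
-- vertices in non-singleton classes induce a forest: a set of them of minimum degree 2 would lie in
-- the 2-core, be closed under core neighbours there, and therefore reach V₂,₃.
-- The isomorphism G ≅ H is then assembled class by class, each time splitting off a class whose
-- vertices have at most one neighbour among the remaining non-singleton vertices.  Adjacency to
-- singleton classes is forced by equitability.  The one remaining neighbour lies either outside the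
-- class, and the class is matched so as to respect it, or inside it, and then the class carries a
-- perfect matching on both sides and is matched orbit by orbit.

module Submission where

open import Defs hiding (sym)
open import Algebra.Bundles using (CommutativeMonoid)
import Algebra.Properties.CommutativeMonoid.Sum as MonoidSum
import Algebra.Properties.CommutativeSemigroup as CommSemigroupProperties
open import Data.Bool using (Bool; true; false; _∧_; _∨_; not; if_then_else_)
open import Data.Bool.Properties
  using (∧-conicalˡ; ∧-conicalʳ; ∧-zeroʳ; ∧-identityʳ; ∧-assoc; ∧-comm; ∧-commutativeMonoid; T-≡)
  renaming (_≟_ to _≟ᵇ_)
open import Data.Empty using (⊥; ⊥-elim)
open import Data.Fin using (Fin; zero; suc; _↑ˡ_; _↑ʳ_)
open import Data.Fin.Properties using (_≟_; any?; splitAt-↑ˡ; splitAt-↑ʳ)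
open import Data.List using (List; []; _∷_; _++_; [_]; length)
import Data.List.Membership.DecPropositional as DecMembership
open import Data.List.Membership.Propositional using (_∈_)
open import Data.List.Membership.Propositional.Properties using (∈-++⁺ˡ; ∈-++⁺ʳ; ∈-++⁻)
open import Data.List.Relation.Unary.Any using (here; there)
open import Data.Nat using (ℕ; zero; suc; _+_; _≤_; _<_; z≤n; s≤s; _≤?_; _≡ᵇ_)
open import Data.Nat.Properties hiding (_≟_)
open import Data.Product using (∃; _×_; _,_; proj₁; proj₂)
open import Data.Sum using (_⊎_; inj₁; inj₂; map₂)
open import Function.Bundles using (_↔_; Inverse; Equivalence; mk↔ₛ′)
open import Relation.Nullary using (¬_; Dec; yes; no; does)
open import Relation.Nullary.Decidable using (dec-true; dec-false; _×-dec_)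
open import Relation.Binary.PropositionalEquality hiding ([_])
open import Algebra.Properties.CommutativeSemigroup +-commutativeSemigroup using (interchange)

-- Booleans and counting over Fin

∧-intro : ∀ {a b} → a ≡ true → b ≡ true → a ∧ b ≡ true
∧-intro refl refl = refl

≡true⇒≢false : ∀ {a} → a ≡ true → a ≢ false
≡true⇒≢false refl ()

bool-cases : (b : Bool) → b ≡ true ⊎ b ≡ false
bool-cases true  = inj₁ refl
bool-cases false = inj₂ refl

bool-ext : ∀ {a b} → (a ≡ true → b ≡ true) → (b ≡ true → a ≡ true) → a ≡ b
bool-ext {false} {false} _ _ = refl
bool-ext {false} {true}  _ q = q refl
bool-ext {true}          p _ = sym (p refl)

not-true⇒false : ∀ {a} → not a ≡ true → a ≡ false
not-true⇒false {false} _ = refl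

∨-introʳ : ∀ a {b} → b ≡ true → a ∨ b ≡ true
∨-introʳ false b = b
∨-introʳ true  _ = refl

∨-elim : ∀ a {b} → a ∨ b ≡ true → a ≡ true ⊎ b ≡ true
∨-elim true  _ = inj₁ refl
∨-elim false b = inj₂ b

∧-congˡ-if : ∀ a {b c} → (a ≡ true → b ≡ c) → a ∧ b ≡ a ∧ c
∧-congˡ-if true  b≡c = b≡c refl
∧-congˡ-if false _   = refl

does-true⇒ : ∀ {p} {P : Set p} (P? : Dec P) → does P? ≡ true → P
does-true⇒ (yes p) _ = p

does-false⇒ : ∀ {p} {P : Set p} (P? : Dec P) → does P? ≡ false → ¬ P
does-false⇒ (no ¬p) _ = ¬p

infix 4 _==_
_==_ : ∀ {N} → Fin N → Fin N → Bool
i == j = does (i ≟ j)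

==-refl : ∀ {N} (i : Fin N) → (i == i) ≡ true
==-refl i = dec-true (i ≟ i) refl

==⇒≡ : ∀ {N} {i j : Fin N} → (i == j) ≡ true → i ≡ j
==⇒≡ {i = i} {j} = does-true⇒ (i ≟ j)

≢⇒==false : ∀ {N} {i j : Fin N} → i ≢ j → (i == j) ≡ false
≢⇒==false {i = i} {j} = dec-false (i ≟ j)

≡ᵇ-true⇒≡ : ∀ {m n} → (m ≡ᵇ n) ≡ true → m ≡ n
≡ᵇ-true⇒≡ {m} {n} p = ≡ᵇ⇒≡ m n (Equivalence.from T-≡ p)

≡⇒≡ᵇ-true : ∀ {m n} → m ≡ n → (m ≡ᵇ n) ≡ true
≡⇒≡ᵇ-true {m} {n} p = Equivalence.to T-≡ (≡⇒≡ᵇ m n p)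

allF-true⇒ : ∀ {N} (f : Fin N → Bool) → allF f ≡ true → ∀ i → f i ≡ true
allF-true⇒ {suc N} f p zero    = ∧-conicalˡ (f zero) _ p
allF-true⇒ {suc N} f p (suc i) = allF-true⇒ (λ i → f (suc i)) (∧-conicalʳ (f zero) _ p) i

allF-intro : ∀ {N} (f : Fin N → Bool) → (∀ i → f i ≡ true) → allF f ≡ true
allF-intro {zero}  f p = refl
allF-intro {suc N} f p = ∧-intro (p zero) (allF-intro (λ i → f (suc i)) (λ i → p (suc i)))

indicator : Bool → ℕ
indicator b = if b then 1 else 0

indicator-injective : ∀ {a b} → indicator a ≡ indicator b → a ≡ b
indicator-injective {false} {false} _ = refl
indicator-injective {true}  {true}  _ = refl

indicator-split : ∀ a b → indicator a ≡ indicator (a ∧ b) + indicator (a ∧ not b)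
indicator-split false b     = refl
indicator-split true  false = refl
indicator-split true  true  = refl

count-cong : ∀ {N} {f g : Fin N → Bool} → (∀ i → f i ≡ g i) → count f ≡ count g
count-cong {zero}  _ = refl
count-cong {suc N} {f} {g} f≗g rewrite f≗g zero = cong (indicator (g zero) +_) (count-cong (λ i → f≗g (suc i)))

count-≡0 : ∀ {N} {f : Fin N → Bool} → (∀ i → f i ≡ false) → count f ≡ 0
count-≡0 {zero}  _ = refl
count-≡0 {suc N} {f} f≡false rewrite f≡false zero = count-≡0 (λ i → f≡false (suc i))

count≡0⇒false : ∀ {N} (f : Fin N → Bool) → count f ≡ 0 → ∀ i → f i ≡ false
count≡0⇒false {suc N} f c zero with f zero
... | false = refl
count≡0⇒false {suc N} f c (suc i) with f zero
... | false = count≡0⇒false (λ i → f (suc i)) c i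

count-∧≡0 : ∀ {N} (a P : Fin N → Bool) → count (λ w → a w ∧ P w) ≡ 0 → ∀ w → P w ≡ true → a w ≡ false
count-∧≡0 a P c w Pw with bool-cases (a w)
... | inj₁ aw = ⊥-elim (≡true⇒≢false (∧-intro aw Pw) (count≡0⇒false _ c w))
... | inj₂ aw = aw

count>0 : ∀ {N} (f : Fin N → Bool) i → f i ≡ true → 1 ≤ count f
count>0 {suc N} f zero    fi rewrite fi = s≤s z≤n
count>0 {suc N} f (suc i) fi = ≤-trans (count>0 (λ i → f (suc i)) i fi) (m≤n+m _ (indicator (f zero)))

count>0⇒witness : ∀ {N} (f : Fin N → Bool) → 1 ≤ count f → ∃ λ i → f i ≡ true
count>0⇒witness {suc N} f c with f zero in f0
... | true  = zero , f0
... | false with count>0⇒witness (λ i → f (suc i)) c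
...   | i , fi = suc i , fi

choose : ∀ {N} → (Fin N → Bool) → Fin N → Fin N
choose f d with any? (λ i → f i ≟ᵇ true)
... | yes (i , _) = i
... | no  _       = d

choose-spec : ∀ {N} (f : Fin N → Bool) d → 1 ≤ count f → f (choose f d) ≡ true
choose-spec f d c with any? (λ i → f i ≟ᵇ true)
... | yes (_ , fi) = fi
... | no  none     = ⊥-elim (none (count>0⇒witness f c))

count≤size : ∀ {N} (f : Fin N → Bool) → count f ≤ N
count≤size {zero}  f = z≤n
count≤size {suc N} f with f zero
... | true  = s≤s (count≤size (λ i → f (suc i)))
... | false = m≤n⇒m≤1+n (count≤size (λ i → f (suc i)))

count-mono : ∀ {N} (f g : Fin N → Bool) → (∀ i → f i ≡ true → g i ≡ true) → count f ≤ count g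
count-mono {zero}  f g f⊆g = z≤n
count-mono {suc N} f g f⊆g with f zero in f0
... | true rewrite f⊆g zero f0 = s≤s (count-mono (λ i → f (suc i)) (λ i → g (suc i)) (λ i → f⊆g (suc i)))
... | false = ≤-trans (count-mono (λ i → f (suc i)) (λ i → g (suc i)) (λ i → f⊆g (suc i))) (m≤n+m _ (indicator (g zero)))

count-< : ∀ {N} (f g : Fin N → Bool) → (∀ i → f i ≡ true → g i ≡ true) →
          ∀ a → f a ≡ false → g a ≡ true → count f < count g
count-< {suc N} f g f⊆g zero fa ga rewrite fa | ga =
  s≤s (count-mono (λ i → f (suc i)) (λ i → g (suc i)) (λ i → f⊆g (suc i)))
count-< {suc N} f g f⊆g (suc a) fa ga with f zero in f0
... | true rewrite f⊆g zero f0 = s≤s (count-< (λ i → f (suc i)) (λ i → g (suc i)) (λ i → f⊆g (suc i)) a fa ga)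
... | false = <-≤-trans (count-< (λ i → f (suc i)) (λ i → g (suc i)) (λ i → f⊆g (suc i)) a fa ga) (m≤n+m _ (indicator (g zero)))

⊆∧count-≥⇒⊇ : ∀ {N} (f g : Fin N → Bool) → (∀ i → f i ≡ true → g i ≡ true) → count g ≤ count f →
              ∀ a → g a ≡ true → f a ≡ true
⊆∧count-≥⇒⊇ f g f⊆g g≤f a ga with bool-cases (f a)
... | inj₁ fa = fa
... | inj₂ fa = ⊥-elim (<⇒≱ (count-< f g f⊆g a fa ga) g≤f)

count-split : ∀ {N} (f g : Fin N → Bool) →
              count f ≡ count (λ i → f i ∧ g i) + count (λ i → f i ∧ not (g i))
count-split {zero}  f g = refl
count-split {suc N} f g =
  trans (cong₂ _+_ (indicator-split (f zero) (g zero)) (count-split (λ i → f (suc i)) (λ i → g (suc i))))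
        (interchange (indicator (f zero ∧ g zero)) _ _ _)

count-single : ∀ {N} (f : Fin N → Bool) (a : Fin N) → count (λ i → f i ∧ (i == a)) ≡ indicator (f a)
count-single {suc N} f zero
  rewrite ∧-identityʳ (f zero) | count-≡0 {f = λ i → f (suc i) ∧ (suc i == zero)} (λ i → ∧-zeroʳ (f (suc i)))
  = +-identityʳ _
count-single {suc N} f (suc a) rewrite ∧-zeroʳ (f zero) = count-single (λ i → f (suc i)) a

count-remove : ∀ {N} (f : Fin N → Bool) (a : Fin N) → count f ≡ count (λ i → f i ∧ not (i == a)) + indicator (f a)
count-remove f a = begin
  count f                                                                    ≡⟨ count-split f (_== a) ⟩
  count (λ i → f i ∧ (i == a)) + count (λ i → f i ∧ not (i == a))
    ≡⟨ cong (_+ count (λ i → f i ∧ not (i == a))) (count-single f a) ⟩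
  indicator (f a) + count (λ i → f i ∧ not (i == a))                         ≡⟨ +-comm (indicator (f a)) _ ⟩
  count (λ i → f i ∧ not (i == a)) + indicator (f a)                         ∎
  where open ≡-Reasoning

count≥2 : ∀ {N} (f : Fin N → Bool) a b → f a ≡ true → f b ≡ true → a ≢ b → 2 ≤ count f
count≥2 f a b fa fb a≢b rewrite count-remove f a | fa | +-comm (count (λ i → f i ∧ not (i == a))) 1 =
  s≤s (count>0 _ b (∧-intro fb (cong not (≢⇒==false (λ b≡a → a≢b (sym b≡a))))))

count≡1⇒unique : ∀ {N} (f : Fin N → Bool) → count f ≡ 1 → ∀ a b → f a ≡ true → f b ≡ true → a ≡ b
count≡1⇒unique f c a b fa fb with a ≟ b
... | yes a≡b = a≡b
... | no  a≢b = ⊥-elim (<⇒≱ (count≥2 f a b fa fb a≢b) (≤-reflexive c))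

count≡1⇒≗== : ∀ {N} (f : Fin N → Bool) a → count f ≡ 1 → f a ≡ true → ∀ i → f i ≡ (i == a)
count≡1⇒≗== f a c fa i = bool-ext (λ fi → subst (λ j → (i == j) ≡ true) (count≡1⇒unique f c i a fi fa) (==-refl i))
                                   (λ i==a → subst (λ j → f j ≡ true) (sym (==⇒≡ i==a)) fa)

count-+ : ∀ m n (f : Fin (m + n) → Bool) → count f ≡ count (λ i → f (i ↑ˡ n)) + count (λ j → f (m ↑ʳ j))
count-+ zero    n f = refl
count-+ (suc m) n f = trans (cong (indicator (f zero) +_) (count-+ m n (λ i → f (suc i)))) (sym (+-assoc (indicator (f zero)) _ _))

module ℕSum = MonoidSum +-0-commutativeMonoid

count-permute : ∀ {m n} (π : Fin m ↔ Fin n) (f : Fin n → Bool) → count (λ i → f (Inverse.to π i)) ≡ count f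
count-permute π f = begin
  count (λ i → f (Inverse.to π i))    ≡⟨ count-sum (λ i → f (Inverse.to π i)) ⟩
  ℕSum.sum (λ i → indicator (f (Inverse.to π i)))  ≡⟨ sym (ℕSum.sum-permute (λ i → indicator (f i)) π) ⟩
  ℕSum.sum (λ i → indicator (f i))          ≡⟨ sym (count-sum f) ⟩
  count f                              ∎
  where
  open ≡-Reasoning
  count-sum : ∀ {N} (f : Fin N → Bool) → count f ≡ ℕSum.sum (λ i → indicator (f i))
  count-sum {zero}  f = refl
  count-sum {suc N} f = cong (indicator (f zero) +_) (count-sum (λ i → f (suc i)))

sum-mono-≤ : ∀ {M} (f g : Fin M → ℕ) → (∀ i → f i ≤ g i) → ℕSum.sum f ≤ ℕSum.sum g
sum-mono-≤ {zero}  f g f≤g = z≤n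
sum-mono-≤ {suc M} f g f≤g = +-mono-≤ (f≤g zero) (sum-mono-≤ (λ i → f (suc i)) (λ i → g (suc i)) (λ i → f≤g (suc i)))

sum-mono-< : ∀ {M} (f g : Fin M → ℕ) → (∀ i → f i ≤ g i) → ∀ j → f j < g j → ℕSum.sum f < ℕSum.sum g
sum-mono-< {suc M} f g f≤g zero    f<g = +-mono-<-≤ f<g (sum-mono-≤ (λ i → f (suc i)) (λ i → g (suc i)) (λ i → f≤g (suc i)))
sum-mono-< {suc M} f g f≤g (suc j) f<g =
  +-mono-≤-< (f≤g zero) (sum-mono-< (λ i → f (suc i)) (λ i → g (suc i)) (λ i → f≤g (suc i)) j f<g)

-- Colour refinement

module ColourRefinement {N} (a : Fin N → Fin N → Bool) where

  SameColour : ℕ → Fin N → Fin N → Set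
  SameColour k x y = eqCol a k x y ≡ true

  neighbourCount : ℕ → Fin N → Fin N → ℕ
  neighbourCount k x z = count (λ w → a x w ∧ eqCol a k w z)

  sameColour-pred : ∀ k x y → SameColour (suc k) x y → SameColour k x y
  sameColour-pred k x y = ∧-conicalˡ (eqCol a k x y) _

  sameColour⇒neighbourCount : ∀ k x y → SameColour (suc k) x y → ∀ z → neighbourCount k x z ≡ neighbourCount k y z
  sameColour⇒neighbourCount k x y p z = ≡ᵇ-true⇒≡ (allF-true⇒ _ (∧-conicalʳ (eqCol a k x y) _ p) z)

  sameColour-suc : ∀ k x y → SameColour k x y → (∀ z → neighbourCount k x z ≡ neighbourCount k y z) → SameColour (suc k) x y
  sameColour-suc k x y p q = ∧-intro p (allF-intro _ (λ z → ≡⇒≡ᵇ-true (q z)))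

  sameColour-refl : ∀ k x → SameColour k x x
  sameColour-refl zero    x = refl
  sameColour-refl (suc k) x = sameColour-suc k x x (sameColour-refl k x) (λ z → refl)

  sameColour-sym : ∀ k x y → SameColour k x y → SameColour k y x
  sameColour-sym zero    x y p = refl
  sameColour-sym (suc k) x y p =
    sameColour-suc k y x (sameColour-sym k x y (sameColour-pred k x y p)) (λ z → sym (sameColour⇒neighbourCount k x y p z))

  sameColour-trans : ∀ k x y z → SameColour k x y → SameColour k y z → SameColour k x z
  sameColour-trans zero    x y z p q = refl
  sameColour-trans (suc k) x y z p q =
    sameColour-suc k x z (sameColour-trans k x y z (sameColour-pred k x y p) (sameColour-pred k y z q))
                   (λ w → trans (sameColour⇒neighbourCount k x y p w) (sameColour⇒neighbourCount k y z q w))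

  eqCol-respʳ : ∀ k x y z → SameColour k y z → eqCol a k x y ≡ eqCol a k x z
  eqCol-respʳ k x y z y~z =
    bool-ext (λ x~y → sameColour-trans k x y z x~y y~z) (λ x~z → sameColour-trans k x z y x~z (sameColour-sym k y z y~z))

  IsStableAt : ℕ → Set
  IsStableAt k = ∀ u v → SameColour k u v → SameColour (suc k) u v

  -- The total size of all colour classes strictly drops at every round that is not stable.
  classSizeTotal : ℕ → ℕ
  classSizeTotal k = ℕSum.sum (λ u → count (eqCol a k u))

  stableRound : ∃ IsStableAt
  stableRound = search (classSizeTotal 0) 0 ≤-refl
    where
    splits : ℕ → Fin N → Fin N → Bool
    splits k u v = eqCol a k u v ∧ not (eqCol a (suc k) u v)

    splitting-shrinks : ∀ k u v → splits k u v ≡ true → classSizeTotal (suc k) < classSizeTotal k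
    splitting-shrinks k u v p =
      sum-mono-< _ _ (λ w → count-mono _ _ (sameColour-pred k w)) u
        (count-< _ _ (sameColour-pred k u) v (not-true⇒false (∧-conicalʳ (eqCol a k u v) _ p)) (∧-conicalˡ _ _ p))

    search : ∀ m k → classSizeTotal k ≤ m → ∃ IsStableAt
    search m k size≤m with any? (λ u → any? (λ v → splits k u v ≟ᵇ true))
    search m       k size≤m | no  none = k , stable
      where
      stable : IsStableAt k
      stable u v p with bool-cases (eqCol a (suc k) u v)
      ... | inj₁ q = q
      ... | inj₂ q = ⊥-elim (none (u , v , ∧-intro p (cong not q)))
    search zero    k size≤m | yes (u , v , p) = ⊥-elim (n≮0 (≤-trans (splitting-shrinks k u v p) size≤m))
    search (suc m) k size≤m | yes (u , v , p) = search m (suc k) (≤-pred (≤-trans (splitting-shrinks k u v p) size≤m))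

module DisjointUnion (G H : Graph) where

  V : Set
  V = Fin (n G + n H)

  inG : Fin (n G) → V
  inG x = x ↑ˡ n H

  inH : Fin (n H) → V
  inH y = n G ↑ʳ y

  adj-GG : ∀ x y → unionAdj G H (inG x) (inG y) ≡ adj G x y
  adj-GG x y rewrite splitAt-↑ˡ (n G) x (n H) | splitAt-↑ˡ (n G) y (n H) = refl

  adj-HH : ∀ x y → unionAdj G H (inH x) (inH y) ≡ adj H x y
  adj-HH x y rewrite splitAt-↑ʳ (n G) (n H) x | splitAt-↑ʳ (n G) (n H) y = refl

  adj-GH : ∀ x y → unionAdj G H (inG x) (inH y) ≡ false
  adj-GH x y rewrite splitAt-↑ˡ (n G) x (n H) | splitAt-↑ʳ (n G) (n H) y = refl

  adj-HG : ∀ x y → unionAdj G H (inH x) (inG y) ≡ false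
  adj-HG x y rewrite splitAt-↑ʳ (n G) (n H) x | splitAt-↑ˡ (n G) y (n H) = refl

  count-+ᵛ : ∀ (P : V → Bool) → count P ≡ count (λ x → P (inG x)) + count (λ y → P (inH y))
  count-+ᵛ = count-+ (n G) (n H)

  neighbours-inG : ∀ x (P : V → Bool) → count (λ w → unionAdj G H (inG x) w ∧ P w) ≡ count (λ w → adj G x w ∧ P (inG w))
  neighbours-inG x P = begin
    count (λ w → unionAdj G H (inG x) w ∧ P w)
      ≡⟨ count-+ᵛ _ ⟩
    count (λ w → unionAdj G H (inG x) (inG w) ∧ P (inG w)) + count (λ w → unionAdj G H (inG x) (inH w) ∧ P (inH w))
      ≡⟨ cong₂ _+_ (count-cong (λ w → cong (_∧ P (inG w)) (adj-GG x w))) (count-≡0 (λ w → cong (_∧ P (inH w)) (adj-GH x w))) ⟩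
    count (λ w → adj G x w ∧ P (inG w)) + 0
      ≡⟨ +-identityʳ _ ⟩
    count (λ w → adj G x w ∧ P (inG w))
      ∎
    where open ≡-Reasoning

  neighbours-inH : ∀ y (P : V → Bool) → count (λ w → unionAdj G H (inH y) w ∧ P w) ≡ count (λ w → adj H y w ∧ P (inH w))
  neighbours-inH y P =
    trans (count-+ᵛ _)
          (cong₂ _+_ (count-≡0 (λ w → cong (_∧ P (inG w)) (adj-HG y w))) (count-cong (λ w → cong (_∧ P (inH w)) (adj-HH y w))))

  module U = ColourRefinement (unionAdj G H)
  module R = ColourRefinement (adj G)

  eqCol-inG : ∀ k x y → eqCol (unionAdj G H) k (inG x) (inG y) ≡ eqCol (adj G) k x y
  eqCol-inG zero    x y = refl
  eqCol-inG (suc k) x y = bool-ext union⇒G G⇒union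
    where
    neighbourCount-inG : ∀ x z → U.neighbourCount k (inG x) (inG z) ≡ R.neighbourCount k x z
    neighbourCount-inG x z = trans (neighbours-inG x _) (count-cong (λ w → cong (adj G x w ∧_) (eqCol-inG k w z)))

    union⇒G : U.SameColour (suc k) (inG x) (inG y) → R.SameColour (suc k) x y
    union⇒G p = R.sameColour-suc k x y (trans (sym (eqCol-inG k x y)) (U.sameColour-pred k _ _ p)) λ z →
      trans (sym (neighbourCount-inG x z)) (trans (U.sameColour⇒neighbourCount k _ _ p (inG z)) (neighbourCount-inG y z))

    -- A colour present in G is the colour of some G-vertex w₀; a colour absent from G contributes 0 on both sides.
    G⇒union : R.SameColour (suc k) x y → U.SameColour (suc k) (inG x) (inG y)
    G⇒union p = U.sameColour-suc k _ _ (trans (eqCol-inG k x y) (R.sameColour-pred k x y p)) counts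
      where
      counts : ∀ z → U.neighbourCount k (inG x) z ≡ U.neighbourCount k (inG y) z
      counts z with count (λ w → eqCol (unionAdj G H) k (inG w) z) in c
      ... | zero = trans (neighbours-inG x _) (trans (count-≡0 (none x)) (sym (trans (neighbours-inG y _) (count-≡0 (none y)))))
        where
        none : ∀ x w → (adj G x w ∧ eqCol (unionAdj G H) k (inG w) z) ≡ false
        none x w = trans (cong (adj G x w ∧_) (count≡0⇒false _ c w)) (∧-zeroʳ _)
      ... | suc _ with count>0⇒witness (λ w → eqCol (unionAdj G H) k (inG w) z) (subst (1 ≤_) (sym c) (s≤s z≤n))
      ...   | w₀ , w₀~z = begin
        U.neighbourCount k (inG x) z     ≡⟨ neighbourCount-z=w₀ x ⟩
        R.neighbourCount k x w₀          ≡⟨ R.sameColour⇒neighbourCount k x y p w₀ ⟩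
        R.neighbourCount k y w₀          ≡⟨ sym (neighbourCount-z=w₀ y) ⟩
        U.neighbourCount k (inG y) z     ∎
        where
        open ≡-Reasoning
        neighbourCount-z=w₀ : ∀ x → U.neighbourCount k (inG x) z ≡ R.neighbourCount k x w₀
        neighbourCount-z=w₀ x = trans (neighbours-inG x _) (count-cong (λ w → cong (adj G x w ∧_)
          (trans (U.eqCol-respʳ k (inG w) z (inG w₀) (U.sameColour-sym k _ _ w₀~z)) (eqCol-inG k w w₀))))

-- Matching two sets orbit by orbit

module ∧-Properties = CommSemigroupProperties (CommutativeMonoid.commutativeSemigroup ∧-commutativeMonoid)

-- Sets with a type function and an involution whose orbits all have size 1 (fixed = true) or all size 2.
module OrbitMatching {r : ℕ} (fixed : Bool) where

  record Orbits {m} (ι : Fin m → Fin m) (t : Fin m → Fin r) (A : Fin m → Bool) : Set where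
    field
      closed     : ∀ x → A x ≡ true → A (ι x) ≡ true
      involutive : ∀ x → A x ≡ true → ι (ι x) ≡ x
      type-ι     : ∀ x → A x ≡ true → t (ι x) ≡ t x
      fixed-ι    : ∀ x → A x ≡ true → (ι x == x) ≡ fixed

  typeCount : ∀ {m} (t : Fin m → Fin r) (A : Fin m → Bool) → Fin r → ℕ
  typeCount t A s = count (λ x → A x ∧ (t x == s))

  -- What one orbit of type s contributes to typeCount at s′: one element, plus its partner unless fixed.
  orbitTypeCount : Fin r → Fin r → ℕ
  orbitTypeCount s s′ = indicator ((s == s′) ∧ not fixed) + indicator (s == s′)

  module RemoveOrbit {m} {ι : Fin m → Fin m} {t : Fin m → Fin r} {A : Fin m → Bool}
                     (O : Orbits ι t A) (x : Fin m) (x∈A : A x ≡ true) where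
    open Orbits O

    A∖x : Fin m → Bool
    A∖x i = A i ∧ (not (i == x) ∧ not (i == ι x))

    ∖⊆ : ∀ i → A∖x i ≡ true → A i ≡ true
    ∖⊆ i p = ∧-conicalˡ (A i) _ p

    ∖≢x : ∀ i → A∖x i ≡ true → i ≢ x
    ∖≢x i p refl = ≡true⇒≢false (∧-conicalˡ _ _ (∧-conicalʳ (A i) _ p)) (cong not (==-refl i))

    ∖≢ιx : ∀ i → A∖x i ≡ true → i ≢ ι x
    ∖≢ιx i p refl = ≡true⇒≢false (∧-conicalʳ _ _ (∧-conicalʳ (A i) _ p)) (cong not (==-refl i))

    ∖-intro : ∀ i → A i ≡ true → i ≢ x → i ≢ ι x → A∖x i ≡ true
    ∖-intro i a i≢x i≢ιx = ∧-intro a (∧-intro (cong not (≢⇒==false i≢x)) (cong not (≢⇒==false i≢ιx)))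

    orbits : Orbits ι t A∖x
    orbits = record
      { closed     = λ i p → ∖-intro (ι i) (closed i (∖⊆ i p))
                               (λ ιi≡x → ∖≢ιx i p (trans (sym (involutive i (∖⊆ i p))) (cong ι ιi≡x)))
                               (λ ιi≡ιx → ∖≢x i p (trans (sym (involutive i (∖⊆ i p))) (trans (cong ι ιi≡ιx) (involutive x x∈A))))
      ; involutive = λ i p → involutive i (∖⊆ i p)
      ; type-ι     = λ i p → type-ι i (∖⊆ i p)
      ; fixed-ι    = λ i p → fixed-ι i (∖⊆ i p)
      }

    typeCount-remove : ∀ s → typeCount t A s ≡ typeCount t A∖x s + orbitTypeCount (t x) s
    typeCount-remove s = begin
      count F
        ≡⟨ count-remove F x ⟩
      count (λ i → F i ∧ not (i == x)) + indicator (F x)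
        ≡⟨ cong (_+ indicator (F x)) (count-remove (λ i → F i ∧ not (i == x)) (ι x)) ⟩
      (count (λ i → (F i ∧ not (i == x)) ∧ not (i == ι x)) + indicator (F (ι x) ∧ not (ι x == x))) + indicator (F x)
        ≡⟨ cong₂ (λ c d → (c + d) + indicator (F x)) (count-cong reorder) (cong indicator ιx-term) ⟩
      (typeCount t A∖x s + indicator ((t x == s) ∧ not fixed)) + indicator (F x)
        ≡⟨ +-assoc (typeCount t A∖x s) _ _ ⟩
      typeCount t A∖x s + (indicator ((t x == s) ∧ not fixed) + indicator (F x))
        ≡⟨ cong (λ b → typeCount t A∖x s + (indicator ((t x == s) ∧ not fixed) + indicator (b ∧ (t x == s)))) x∈A ⟩
      typeCount t A∖x s + orbitTypeCount (t x) s
        ∎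
      where
      open ≡-Reasoning
      F : Fin m → Bool
      F i = A i ∧ (t i == s)
      reorder : ∀ i → (F i ∧ not (i == x)) ∧ not (i == ι x) ≡ A∖x i ∧ (t i == s)
      reorder i = trans (∧-assoc (F i) _ _) (∧-Properties.xy∙z≈xz∙y (A i) (t i == s) _)
      ιx-term : F (ι x) ∧ not (ι x == x) ≡ (t x == s) ∧ not fixed
      ιx-term rewrite closed x x∈A | type-ι x x∈A | fixed-ι x x∈A = refl

    count-∖ : count A∖x < count A
    count-∖ = count-< A∖x A ∖⊆ x (trans (cong (λ b → A x ∧ (not b ∧ not (x == ι x))) (==-refl x)) (∧-zeroʳ (A x))) x∈A

    data Position (i : Fin m) : Set where
      at-x   : i ≡ x → Position i
      at-ιx  : ι x ≢ x → i ≡ ι x → Position i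
      inside : A∖x i ≡ true → Position i

    position : ∀ i → A i ≡ true → Position i
    position i a with i ≟ x | i ≟ ι x
    ... | yes i≡x | _        = at-x i≡x
    ... | no  i≢x | yes i≡ιx = at-ιx (λ ιx≡x → i≢x (trans i≡ιx ιx≡x)) i≡ιx
    ... | no  i≢x | no  i≢ιx = inside (∖-intro i a i≢x i≢ιx)

  record Matching {m m′} (ιA : Fin m → Fin m) (ιB : Fin m′ → Fin m′) (tA : Fin m → Fin r) (tB : Fin m′ → Fin r)
                  (A : Fin m → Bool) (B : Fin m′ → Bool) : Set where
    field
      g      : Fin m → Fin m′
      k      : Fin m′ → Fin m
      g∈B    : ∀ x → A x ≡ true → B (g x) ≡ true
      k∈A    : ∀ y → B y ≡ true → A (k y) ≡ true
      k∘g    : ∀ x → A x ≡ true → k (g x) ≡ x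
      g∘k    : ∀ y → B y ≡ true → g (k y) ≡ y
      type-g : ∀ x → A x ≡ true → tB (g x) ≡ tA x
      g-ι    : ∀ x → A x ≡ true → g (ιA x) ≡ ιB (g x)

  redirect : ∀ {m m′} (ι : Fin m → Fin m) (ι′ : Fin m′ → Fin m′) (x : Fin m) (y : Fin m′) →
             (Fin m → Fin m′) → Fin m → Fin m′
  redirect ι ι′ x y g i = if i == x then y else (if i == ι x then ι′ y else g i)

  module _ {m m′} (ι : Fin m → Fin m) (ι′ : Fin m′ → Fin m′) (x : Fin m) (y : Fin m′) (g : Fin m → Fin m′) where

    redirect-x : redirect ι ι′ x y g x ≡ y
    redirect-x rewrite ==-refl x = refl

    redirect-ιx : ι x ≢ x → redirect ι ι′ x y g (ι x) ≡ ι′ y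
    redirect-ιx ιx≢x rewrite ≢⇒==false ιx≢x | ==-refl (ι x) = refl

    redirect-other : ∀ i → i ≢ x → i ≢ ι x → redirect ι ι′ x y g i ≡ g i
    redirect-other i i≢x i≢ιx rewrite ≢⇒==false i≢x | ≢⇒==false i≢ιx = refl

  fixed-transfer : ∀ {m m′} {ιA : Fin m → Fin m} {tA : Fin m → Fin r} {A : Fin m → Bool}
                   {ιB : Fin m′ → Fin m′} {tB : Fin m′ → Fin r} {B : Fin m′ → Bool} →
                   Orbits ιA tA A → Orbits ιB tB B → ∀ {x y} → A x ≡ true → B y ≡ true → ιA x ≡ x → ιB y ≡ y
  fixed-transfer OA OB {x} {y} x∈A y∈B ιx≡x =
    ==⇒≡ (trans (Orbits.fixed-ι OB y y∈B) (trans (sym (Orbits.fixed-ι OA x x∈A)) (trans (cong (_== x) ιx≡x) (==-refl x))))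

  module Extend {m m′} {ιA : Fin m → Fin m} {tA : Fin m → Fin r} {A : Fin m → Bool}
                       {ιB : Fin m′ → Fin m′} {tB : Fin m′ → Fin r} {B : Fin m′ → Bool}
                (OA : Orbits ιA tA A) (OB : Orbits ιB tB B)
                (x : Fin m) (x∈A : A x ≡ true) (y : Fin m′) (y∈B : B y ≡ true) where
    module RA = RemoveOrbit OA x x∈A
    module RB = RemoveOrbit OB y y∈B
    open Orbits

    extend : (Fin m → Fin m′) → Fin m → Fin m′
    extend = redirect ιA ιB x y

    extend-inside : ∀ g i → RA.A∖x i ≡ true → extend g i ≡ g i
    extend-inside g i p = redirect-other ιA ιB x y g i (RA.∖≢x i p) (RA.∖≢ιx i p)

    extend-into : ∀ g → (∀ i → RA.A∖x i ≡ true → RB.A∖x (g i) ≡ true) → ∀ i → A i ≡ true → B (extend g i) ≡ true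
    extend-into g into i a with RA.position i a
    ... | RA.at-x refl        = subst (λ j → B j ≡ true) (sym (redirect-x ιA ιB x y g)) y∈B
    ... | RA.at-ιx ιx≢x refl  = subst (λ j → B j ≡ true) (sym (redirect-ιx ιA ιB x y g ιx≢x)) (closed OB y y∈B)
    ... | RA.inside p         = subst (λ j → B j ≡ true) (sym (extend-inside g i p)) (RB.∖⊆ (g i) (into i p))

    extend-inverse : ∀ g k → (∀ i → RA.A∖x i ≡ true → RB.A∖x (g i) ≡ true) → (∀ i → RA.A∖x i ≡ true → k (g i) ≡ i) →
                     ∀ i → A i ≡ true → redirect ιB ιA y x k (extend g i) ≡ i
    extend-inverse g k into inverse i a with RA.position i a
    ... | RA.at-x refl       = trans (cong (redirect ιB ιA y x k) (redirect-x ιA ιB x y g)) (redirect-x ιB ιA y x k)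
    ... | RA.at-ιx ιx≢x refl = trans (cong (redirect ιB ιA y x k) (redirect-ιx ιA ιB x y g ιx≢x))
                                     (redirect-ιx ιB ιA y x k (λ ιy≡y → ιx≢x (fixed-transfer OB OA y∈B x∈A ιy≡y)))
    ... | RA.inside p        = trans (cong (redirect ιB ιA y x k) (extend-inside g i p))
                                     (trans (redirect-other ιB ιA y x k (g i) (RB.∖≢x (g i) (into i p)) (RB.∖≢ιx (g i) (into i p)))
                                            (inverse i p))

    extend-type : ∀ g → tB y ≡ tA x → (∀ i → RA.A∖x i ≡ true → tB (g i) ≡ tA i) →
                  ∀ i → A i ≡ true → tB (extend g i) ≡ tA i
    extend-type g ty≡tx type-g i a with RA.position i a
    ... | RA.at-x refl       = trans (cong tB (redirect-x ιA ιB x y g)) ty≡tx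
    ... | RA.at-ιx ιx≢x refl = begin
      tB (extend g (ιA x))  ≡⟨ cong tB (redirect-ιx ιA ιB x y g ιx≢x) ⟩
      tB (ιB y)             ≡⟨ type-ι OB y y∈B ⟩
      tB y                  ≡⟨ ty≡tx ⟩
      tA x                  ≡⟨ sym (type-ι OA x x∈A) ⟩
      tA (ιA x)             ∎
      where open ≡-Reasoning
    ... | RA.inside p        = trans (cong tB (extend-inside g i p)) (type-g i p)

    extend-ι : ∀ g → (∀ i → RA.A∖x i ≡ true → g (ιA i) ≡ ιB (g i)) →
               ∀ i → A i ≡ true → extend g (ιA i) ≡ ιB (extend g i)
    extend-ι g g-ι i a with RA.position i a
    ... | RA.at-x refl = at-x (ιA x ≟ x)
      where
      at-x : Dec (ιA x ≡ x) → extend g (ιA x) ≡ ιB (extend g x)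
      at-x (yes ιx≡x) = begin
        extend g (ιA x)  ≡⟨ cong (extend g) ιx≡x ⟩
        extend g x       ≡⟨ redirect-x ιA ιB x y g ⟩
        y                ≡⟨ sym (fixed-transfer OA OB x∈A y∈B ιx≡x) ⟩
        ιB y             ≡⟨ cong ιB (sym (redirect-x ιA ιB x y g)) ⟩
        ιB (extend g x)  ∎
        where open ≡-Reasoning
      at-x (no ιx≢x) = trans (redirect-ιx ιA ιB x y g ιx≢x) (cong ιB (sym (redirect-x ιA ιB x y g)))
    extend-ι g g-ι i a | RA.at-ιx ιx≢x refl = begin
      extend g (ιA (ιA x))  ≡⟨ cong (extend g) (involutive OA x x∈A) ⟩
      extend g x            ≡⟨ redirect-x ιA ιB x y g ⟩
      y                     ≡⟨ sym (involutive OB y y∈B) ⟩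
      ιB (ιB y)             ≡⟨ cong ιB (sym (redirect-ιx ιA ιB x y g ιx≢x)) ⟩
      ιB (extend g (ιA x))  ∎
      where open ≡-Reasoning
    extend-ι g g-ι i a | RA.inside p = begin
      extend g (ιA i)  ≡⟨ extend-inside g (ιA i) (closed RA.orbits i p) ⟩
      g (ιA i)         ≡⟨ g-ι i p ⟩
      ιB (g i)         ≡⟨ cong ιB (sym (extend-inside g i p)) ⟩
      ιB (extend g i)  ∎
      where open ≡-Reasoning

  typeCount>0 : ∀ {m} (t : Fin m → Fin r) (A : Fin m → Bool) x → A x ≡ true → 1 ≤ typeCount t A (t x)
  typeCount>0 t A x x∈A = count>0 _ x (∧-intro x∈A (==-refl (t x)))

  -- g₀ and k₀ only supply the values outside A and B, which a Matching leaves unconstrained.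
  module _ {m m′} {ιA : Fin m → Fin m} {tA : Fin m → Fin r} {ιB : Fin m′ → Fin m′} {tB : Fin m′ → Fin r}
           (g₀ : Fin m → Fin m′) (k₀ : Fin m′ → Fin m) where

    matching : ∀ fuel {A B} → count A ≤ fuel → Orbits ιA tA A → Orbits ιB tB B →
               (∀ s → typeCount tA A s ≡ typeCount tB B s) → Matching ιA ιB tA tB A B
    matching fuel {A} {B} size OA OB counts with count A in c
    ... | zero = record
      { g = g₀ ; k = k₀
      ; g∈B = λ x a → ⊥-elim (A-empty x a) ; k∈A = λ y b → ⊥-elim (B-empty y b)
      ; k∘g = λ x a → ⊥-elim (A-empty x a) ; g∘k = λ y b → ⊥-elim (B-empty y b)
      ; type-g = λ x a → ⊥-elim (A-empty x a) ; g-ι = λ x a → ⊥-elim (A-empty x a)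
      }
      where
      A-empty : ∀ x → A x ≢ true
      A-empty x a = ≡true⇒≢false a (count≡0⇒false A c x)
      B-empty : ∀ y → B y ≢ true
      B-empty y b with count>0⇒witness _ (subst (1 ≤_) (sym (counts (tB y))) (typeCount>0 tB B y b))
      ... | x , p = A-empty x (∧-conicalˡ (A x) _ p)
    matching zero {A} {B} size OA OB counts | suc _ = ⊥-elim (n≮0 size)
    matching (suc fuel) {A} {B} size OA OB counts | suc _
      with count>0⇒witness A (subst (1 ≤_) (sym c) (s≤s z≤n))
    ... | x , x∈A with count>0⇒witness _ (subst (1 ≤_) (counts (tA x)) (typeCount>0 tA A x x∈A))
    ... | y , y∈B∧ty≡tx = record
      { g = E.extend R.g ; k = E′.extend R.k
      ; g∈B = E.extend-into R.g R.g∈B ; k∈A = E′.extend-into R.k R.k∈A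
      ; k∘g = E.extend-inverse R.g R.k R.g∈B R.k∘g ; g∘k = E′.extend-inverse R.k R.g R.k∈A R.g∘k
      ; type-g = E.extend-type R.g ty≡tx R.type-g ; g-ι = E.extend-ι R.g R.g-ι
      }
      where
      y∈B : B y ≡ true
      y∈B = ∧-conicalˡ (B y) _ y∈B∧ty≡tx
      ty≡tx : tB y ≡ tA x
      ty≡tx = ==⇒≡ (∧-conicalʳ (B y) _ y∈B∧ty≡tx)
      module E = Extend OA OB x x∈A y y∈B
      module E′ = Extend OB OA y y∈B x x∈A
      counts′ : ∀ s → typeCount tA E.RA.A∖x s ≡ typeCount tB E.RB.A∖x s
      counts′ s = +-cancelʳ-≡ (orbitTypeCount (tA x) s) _ _ (begin
        typeCount tA E.RA.A∖x s + orbitTypeCount (tA x) s  ≡⟨ sym (E.RA.typeCount-remove s) ⟩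
        typeCount tA A s                                   ≡⟨ counts s ⟩
        typeCount tB B s                                   ≡⟨ E.RB.typeCount-remove s ⟩
        typeCount tB E.RB.A∖x s + orbitTypeCount (tB y) s  ≡⟨ cong (λ t → typeCount tB E.RB.A∖x s + orbitTypeCount t s) ty≡tx ⟩
        typeCount tB E.RB.A∖x s + orbitTypeCount (tA x) s  ∎)
        where open ≡-Reasoning
      module R = Matching (matching fuel (≤-pred (≤-trans E.RA.count-∖ (subst (_≤ suc fuel) (sym c) size)))
                                    E.RA.orbits E.RB.orbits counts′)

identityOrbits : ∀ {r m} (t : Fin m → Fin r) (A : Fin m → Bool) → OrbitMatching.Orbits true (λ x → x) t A
identityOrbits t A = record
  { closed = λ x a → a ; involutive = λ x _ → refl ; type-ι = λ x _ → refl ; fixed-ι = λ x _ → ==-refl x }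

constant-typeCounts : ∀ {r m m′} (fixed : Bool) (s₀ : Fin r) (A : Fin m → Bool) (B : Fin m′ → Bool) → count A ≡ count B →
                      ∀ s → OrbitMatching.typeCount fixed (λ _ → s₀) A s ≡ OrbitMatching.typeCount fixed (λ _ → s₀) B s
constant-typeCounts fixed s₀ A B A≡B s with bool-cases (s₀ == s)
... | inj₁ same      = trans (count-cong (λ x → trans (cong (A x ∧_) same) (∧-identityʳ _)))
                             (trans A≡B (sym (count-cong (λ y → trans (cong (B y ∧_) same) (∧-identityʳ _)))))
... | inj₂ different = trans (count-≡0 (λ x → trans (cong (A x ∧_) different) (∧-zeroʳ _)))
                             (sym (count-≡0 (λ y → trans (cong (B y ∧_) different) (∧-zeroʳ _))))

-- Walks and the 2-core

adj⇒≢ : ∀ G {x y} → adj G x y ≡ true → x ≢ y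
adj⇒≢ G {x} e refl = ≡true⇒≢false e (Graph.irrefl G x)

module Walks (G : Graph) where

  V : Set
  V = Fin (n G)

  data Walk : List V → Set where
    stop : ∀ x → Walk (x ∷ [])
    _∷_ : ∀ {x y r} → adj G x y ≡ true → Walk (y ∷ r) → Walk (x ∷ y ∷ r)

  last : V → List V → V
  last a []      = a
  last a (x ∷ r) = last x r

  walk-first-edge : ∀ {a y r} → Walk (a ∷ y ∷ r) → adj G a y ≡ true
  walk-first-edge (e ∷ _) = e

  walk-edges-at : ∀ ps {u v w qs} → Walk (ps ++ (u ∷ v ∷ w ∷ qs)) → adj G u v ≡ true × adj G v w ≡ true
  walk-edges-at []           (e ∷ (e′ ∷ _)) = e , e′
  walk-edges-at (x ∷ [])     (_ ∷ ω)        = walk-edges-at [] ω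
  walk-edges-at (x ∷ y ∷ ps) (_ ∷ ω)        = walk-edges-at (y ∷ ps) ω

  walk-cut : ∀ ps {u v qs} → Walk (ps ++ (u ∷ v ∷ u ∷ qs)) → Walk (ps ++ (u ∷ qs))
  walk-cut []           (_ ∷ (_ ∷ ω)) = ω
  walk-cut (x ∷ [])     (e ∷ ω)       = e ∷ walk-cut [] ω
  walk-cut (x ∷ y ∷ ps) (e ∷ ω)       = e ∷ walk-cut (y ∷ ps) ω

  last-cut : ∀ ps {u v qs} d → last d (ps ++ (u ∷ v ∷ u ∷ qs)) ≡ last d (ps ++ (u ∷ qs))
  last-cut []       d = refl
  last-cut (x ∷ ps) d = last-cut ps x

  ∈-cut : ∀ {z} (ps : List V) {u v qs} → z ∈ ps ++ (u ∷ qs) → z ∈ ps ++ (u ∷ v ∷ u ∷ qs)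
  ∈-cut ps z∈ with ∈-++⁻ ps z∈
  ... | inj₁ z∈ps         = ∈-++⁺ˡ z∈ps
  ... | inj₂ (here z≡u)   = ∈-++⁺ʳ ps (here z≡u)
  ... | inj₂ (there z∈qs) = ∈-++⁺ʳ ps (there (there (there z∈qs)))

  length-cut : ∀ (ps : List V) u v qs → length (ps ++ (u ∷ qs)) < length (ps ++ (u ∷ v ∷ u ∷ qs))
  length-cut []       u v qs = n≤1+n (suc (suc (length qs)))
  length-cut (x ∷ ps) u v qs = s≤s (length-cut ps u v qs)

  split-at-interior : ∀ {v} x r → v ∈ x ∷ r → x ≢ v → last x r ≢ v →
                      ∃ λ ps → ∃ λ u → ∃ λ w → ∃ λ qs → x ∷ r ≡ ps ++ (u ∷ v ∷ w ∷ qs)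
  split-at-interior x [] (here v≡x) x≢v _ = ⊥-elim (x≢v (sym v≡x))
  split-at-interior {v} x (y ∷ r) v∈ x≢v last≢v with y ≟ v
  split-at-interior x (y ∷ [])     v∈ x≢v last≢v | yes y≡v = ⊥-elim (last≢v y≡v)
  split-at-interior x (y ∷ w ∷ qs) v∈ x≢v last≢v | yes refl = [] , x , w , qs , refl
  split-at-interior x (y ∷ r) (here v≡x) x≢v last≢v | no y≢v = ⊥-elim (x≢v (sym v≡x))
  split-at-interior x (y ∷ r) (there v∈) x≢v last≢v | no y≢v with split-at-interior y r v∈ y≢v last≢v
  ... | ps , u , w , qs , eq = x ∷ ps , u , w , qs , cong (x ∷_) eq

  head-cut : ∀ (ps : List V) {a r u v qs} → a ∷ r ≡ ps ++ (u ∷ v ∷ u ∷ qs) → ∃ λ r′ → a ∷ r′ ≡ ps ++ (u ∷ qs)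
  head-cut []       refl = _ , refl
  head-cut (x ∷ ps) refl = _ , refl

  walk-snoc : ∀ {a} r {w} → Walk (a ∷ r) → adj G (last a r) w ≡ true → Walk (a ∷ r ++ [ w ])
  walk-snoc []      (stop _) e = e ∷ stop _
  walk-snoc (y ∷ r) (e ∷ ω)  e′ = e ∷ walk-snoc r ω e′

  last-snoc : ∀ a r w → last a (r ++ [ w ]) ≡ w
  last-snoc a []      w = refl
  last-snoc a (x ∷ r) w = last-snoc x r w

minDeg2-or-low : (G : Graph) (U : VSet G) → MinDeg2 G U ⊎ ∃ λ v → U v ≡ true × degIn G U v ≤ 1
minDeg2-or-low G U with any? (λ v → (U v ≟ᵇ true) ×-dec (degIn G U v ≤? 1))
... | yes low  = inj₂ low
... | no  none = inj₁ min-degree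
  where
  min-degree : MinDeg2 G U
  min-degree v v∈U with 2 ≤? degIn G U v
  ... | yes two≤ = two≤
  ... | no  ≱2   = ⊥-elim (none (v , v∈U , ≤-pred (≰⇒> ≱2)))

-- Inside the 2-core S, a set T that is closed under S-neighbours cannot be left along a walk
-- that returns to S: the walk together with S would have minimum degree 2 once its backtracks are cut.
module CoreClosure (G : Graph) (S : VSet G) (core : IsTwoCore G S)
                   (T : VSet G) (T⊆S : ∀ v → T v ≡ true → S v ≡ true)
                   (T-closed : ∀ a b → T a ≡ true → S b ≡ true → adj G a b ≡ true → T b ≡ true) where
  open Walks G
  open DecMembership (_≟_ {n G}) using (_∈?_)

  S+ : List V → VSet G
  S+ ws v = S v ∨ does (v ∈? ws)

  S+-walk : ∀ ws {v} → v ∈ ws → S+ ws v ≡ true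
  S+-walk ws {v} v∈ = ∨-introʳ (S v) (dec-true (v ∈? ws) v∈)

  S+-degree : ∀ ws v → S v ≡ true → 2 ≤ degIn G (S+ ws) v
  S+-degree ws v v∈S = ≤-trans (proj₁ core v v∈S)
    (count-mono _ _ (λ w p → ∧-intro (cong (_∨ _) (∧-conicalˡ (S w) _ p)) (∧-conicalʳ (S w) _ p)))

  record Detour (a : V) (r : List V) : Set where
    field
      walk      : Walk (a ∷ r)
      start∈T   : T a ≡ true
      end∈S     : S (last a r) ≡ true
      end∉T     : T (last a r) ≡ false
      only-ends : ∀ z → z ∈ a ∷ r → S z ≡ true → z ≡ a ⊎ z ≡ last a r

  detour-¬minDeg2 : ∀ {a y r} → Detour a (y ∷ r) → ¬ MinDeg2 G (S+ (a ∷ y ∷ r))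
  detour-¬minDeg2 {a} {y} {r} δ min-degree = second-vertex (only-ends y (there (here refl)) y∈S)
    where
    open Detour δ
    y∈S : S y ≡ true
    y∈S = proj₂ core _ min-degree y (S+-walk (a ∷ y ∷ r) (there (here refl)))
    second-vertex : y ≡ a ⊎ y ≡ last a (y ∷ r) → ⊥
    second-vertex (inj₁ y≡a) = adj⇒≢ G (walk-first-edge walk) (sym y≡a)
    second-vertex (inj₂ y≡b) = ≡true⇒≢false (T-closed a y start∈T y∈S (walk-first-edge walk)) (trans (cong T y≡b) end∉T)

  low-vertex-backtrack : ∀ {a r v} → Detour a r → S+ (a ∷ r) v ≡ true → degIn G (S+ (a ∷ r)) v ≤ 1 →
                         ∃ λ ps → ∃ λ u → ∃ λ qs → a ∷ r ≡ ps ++ (u ∷ v ∷ u ∷ qs)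
  low-vertex-backtrack {a} {r} {v} δ v∈S+ deg≤1 with split-at-interior a r v∈walk (v∉S (T⊆S a start∈T)) (v∉S end∈S)
    where
    open Detour δ
    v∉S : ∀ {x} → S x ≡ true → x ≢ v
    v∉S x∈S refl = <⇒≱ (s≤s deg≤1) (S+-degree (a ∷ r) v x∈S)
    v∈walk : v ∈ a ∷ r
    v∈walk with ∨-elim (S v) v∈S+
    ... | inj₁ v∈S  = ⊥-elim (v∉S v∈S refl)
    ... | inj₂ v∈?  = does-true⇒ (v ∈? (a ∷ r)) v∈?
  ... | ps , u , w , qs , eq with u ≟ w
  ...   | yes refl = ps , u , qs , eq
  ...   | no  u≢w  = ⊥-elim (<⇒≱ (s≤s deg≤1) (count≥2 _ u w (neighbour u∈ (trans (Graph.sym G v u) u-v)) (neighbour w∈ v-w) u≢w))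
    where
    u-v : adj G u v ≡ true
    u-v = proj₁ (walk-edges-at ps (subst Walk eq (Detour.walk δ)))
    v-w : adj G v w ≡ true
    v-w = proj₂ (walk-edges-at ps (subst Walk eq (Detour.walk δ)))
    u∈ : u ∈ a ∷ r
    u∈ = subst (u ∈_) (sym eq) (∈-++⁺ʳ ps (here refl))
    w∈ : w ∈ a ∷ r
    w∈ = subst (w ∈_) (sym eq) (∈-++⁺ʳ ps (there (there (here refl))))
    neighbour : ∀ {z} → z ∈ a ∷ r → adj G v z ≡ true → (S+ (a ∷ r) z ∧ adj G v z) ≡ true
    neighbour z∈ e = ∧-intro (S+-walk (a ∷ r) z∈) e

  detour-cut : ∀ {a r} ps {u v qs} → Detour a r → a ∷ r ≡ ps ++ (u ∷ v ∷ u ∷ qs) →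
               ∃ λ r′ → Detour a r′ × length r′ < length r
  detour-cut {a} {r} ps {u} {v} {qs} δ eq with head-cut ps eq
  ... | r′ , eq′ = r′ , δ′ , ≤-pred (subst₂ _<_ (cong length (sym eq′)) (cong length (sym eq)) (length-cut ps u v qs))
    where
    open Detour δ
    last≡ : last a r ≡ last a r′
    last≡ = trans (cong (last a) eq) (trans (last-cut ps a) (cong (last a) (sym eq′)))
    δ′ : Detour a r′
    δ′ = record
      { walk      = subst Walk (sym eq′) (walk-cut ps (subst Walk eq walk))
      ; start∈T   = start∈T
      ; end∈S     = subst (λ t → S t ≡ true) last≡ end∈S
      ; end∉T     = subst (λ t → T t ≡ false) last≡ end∉T
      ; only-ends = λ z z∈ z∈S → map₂ (λ z≡b → trans z≡b last≡)
                                   (only-ends z (subst (z ∈_) (sym eq) (∈-cut ps (subst (z ∈_) eq′ z∈))) z∈S)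
      }

  no-detour : ∀ ℓ {a r} → length r ≤ ℓ → Detour a r → ⊥
  no-detour ℓ       {r = []}    _   δ = ≡true⇒≢false (Detour.start∈T δ) (Detour.end∉T δ)
  no-detour zero    {r = y ∷ r} ()  δ
  no-detour (suc ℓ) {a} {y ∷ r} len δ with minDeg2-or-low G (S+ (a ∷ y ∷ r))
  ... | inj₁ min-degree = detour-¬minDeg2 δ min-degree
  ... | inj₂ (v , v∈S+ , deg≤1) with low-vertex-backtrack δ v∈S+ deg≤1
  ...   | ps , u , qs , eq with detour-cut ps δ eq
  ...     | r′ , δ′ , shorter = no-detour ℓ (≤-pred (≤-trans shorter len)) δ′

  data Reached (w : V) : Set where
    in-T    : T w ≡ true → Reached w
    hanging : S w ≡ false → ∀ a r → Walk (a ∷ r) → T a ≡ true → last a r ≡ w →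
              (∀ z → z ∈ a ∷ r → S z ≡ true → z ≡ a) → Reached w

  reached : ∀ {t w} → T t ≡ true → Reach G t w → Reached w
  reached t∈T here = in-T t∈T
  reached {w = w} t∈T (step {v} ρ e) with reached t∈T ρ
  ... | in-T v∈T with bool-cases (S w)
  ...   | inj₁ w∈S = in-T (T-closed v w v∈T w∈S e)
  ...   | inj₂ w∉S = hanging w∉S v [ w ] (e ∷ stop w) v∈T refl only-start
    where
    only-start : ∀ z → z ∈ v ∷ [ w ] → S z ≡ true → z ≡ v
    only-start z (here z≡v)         _   = z≡v
    only-start z (there (here refl)) z∈S = ⊥-elim (≡true⇒≢false z∈S w∉S)
  reached {w = w} t∈T (step ρ e) | hanging v∉S a r ω a∈T last≡v only-start with bool-cases (T w) | bool-cases (S w)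
  ... | inj₁ w∈T | _        = in-T w∈T
  ... | inj₂ w∉T | inj₁ w∈S =
    ⊥-elim (no-detour (length (r ++ [ w ])) ≤-refl (record
      { walk      = ω′
      ; start∈T   = a∈T
      ; end∈S     = subst (λ t → S t ≡ true) (sym (last-snoc a r w)) w∈S
      ; end∉T     = subst (λ t → T t ≡ false) (sym (last-snoc a r w)) w∉T
      ; only-ends = only-ends }))
    where
    ω′ : Walk (a ∷ r ++ [ w ])
    ω′ = walk-snoc r ω (subst (λ t → adj G t w ≡ true) (sym last≡v) e)
    only-ends : ∀ z → z ∈ a ∷ r ++ [ w ] → S z ≡ true → z ≡ a ⊎ z ≡ last a (r ++ [ w ])
    only-ends z z∈ z∈S with ∈-++⁻ (a ∷ r) z∈
    ... | inj₁ z∈ar       = inj₁ (only-start z z∈ar z∈S)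
    ... | inj₂ (here z≡w) = inj₂ (trans z≡w (sym (last-snoc a r w)))
  ... | inj₂ w∉T | inj₂ w∉S =
    hanging w∉S a (r ++ [ w ]) (walk-snoc r ω (subst (λ t → adj G t w ≡ true) (sym last≡v) e)) a∈T (last-snoc a r w) only-start′
    where
    only-start′ : ∀ z → z ∈ a ∷ r ++ [ w ] → S z ≡ true → z ≡ a
    only-start′ z z∈ z∈S with ∈-++⁻ (a ∷ r) z∈
    ... | inj₁ z∈ar       = only-start z z∈ar z∈S
    ... | inj₂ (here refl) = ⊥-elim (≡true⇒≢false z∈S w∉S)

  reach-closed : ∀ {t u} → T t ≡ true → S u ≡ true → Reach G t u → T u ≡ true
  reach-closed t∈T u∈S ρ with reached t∈T ρ
  ... | in-T u∈T                 = u∈T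
  ... | hanging u∉S _ _ _ _ _ _  = ⊥-elim (≡true⇒≢false u∈S u∉S)

OneDegenerateOn : (G : Graph) → (Fin (n G) → Set) → Set
OneDegenerateOn G U =
  ∀ (T : VSet G) → (∀ x → T x ≡ true → U x) → ∀ x₀ → T x₀ ≡ true → ∃ λ x → T x ≡ true × degIn G T x ≤ 1

-- If T had minimum degree 2 it would lie in the 2-core with core degree 2 everywhere, hence be closed
-- under core neighbours, and by connectivity it would contain the vertex of V₂,₃.
oneDegenerate-outside-V23 : ∀ {G S v} → Connected G → IsTwoCore G S → InV23 G S v →
                            OneDegenerateOn G (λ x → ¬ InV23 G S x)
oneDegenerate-outside-V23 {G} {S} {v} connected core v∈V23 T T∩V23=∅ x₀ x₀∈T with minDeg2-or-low G T
... | inj₂ low        = low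
... | inj₁ min-degree = ⊥-elim (T∩V23=∅ v v∈T v∈V23)
  where
  T⊆S : ∀ x → T x ≡ true → S x ≡ true
  T⊆S = proj₂ core T min-degree
  core-degree≤2 : ∀ x → T x ≡ true → degIn G S x ≤ 2
  core-degree≤2 x x∈T with 3 ≤? degIn G S x
  ... | yes three≤ = ⊥-elim (T∩V23=∅ x x∈T (T⊆S x x∈T , three≤))
  ... | no  ≱3     = ≤-pred (≰⇒> ≱3)
  T-closed : ∀ a b → T a ≡ true → S b ≡ true → adj G a b ≡ true → T b ≡ true
  T-closed a b a∈T b∈S e = ∧-conicalˡ (T b) _
    (⊆∧count-≥⇒⊇ (λ w → T w ∧ adj G a w) (λ w → S w ∧ adj G a w)
                 (λ w p → ∧-intro (T⊆S w (∧-conicalˡ (T w) _ p)) (∧-conicalʳ (T w) _ p))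
                 (≤-trans (core-degree≤2 a a∈T) (min-degree a a∈T)) b (∧-intro b∈S e))
  v∈T : T v ≡ true
  v∈T = CoreClosure.reach-closed G S core T T⊆S T-closed x₀∈T (proj₁ v∈V23) (connected x₀ v)

oneDegenerateOn-mono : ∀ {G} {U U′ : Fin (n G) → Set} → (∀ x → U x → U′ x) → OneDegenerateOn G U′ → OneDegenerateOn G U
oneDegenerateOn-mono U⊆U′ degenerate T T⊆U = degenerate T (λ x t → U⊆U′ x (T⊆U x t))

-- The stable colouring of G + H

module StableUnion (G H : Graph) (K : ℕ)
                   (stable : ColourRefinement.IsStableAt (unionAdj G H) K)
                   (same : SameMultisetAt G H K) where
  open DisjointUnion G H public

  A : V → V → Bool
  A = unionAdj G H

  E : V → V → Bool
  E = eqCol A K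

  infix 4 _~_
  _~_ : V → V → Set
  u ~ v = E u v ≡ true

  ~-refl : ∀ u → u ~ u
  ~-refl = U.sameColour-refl K

  ~-sym : ∀ u v → u ~ v → v ~ u
  ~-sym = U.sameColour-sym K

  ~-trans : ∀ u v w → u ~ v → v ~ w → u ~ w
  ~-trans = U.sameColour-trans K

  E-respˡ : ∀ z u v → u ~ v → E u z ≡ E v z
  E-respˡ z u v u~v = bool-ext (~-trans v u z (~-sym u v u~v)) (~-trans u v z u~v)

  E-respʳ : ∀ z u v → u ~ v → E z u ≡ E z v
  E-respʳ = U.eqCol-respʳ K

  ClassClosed : (V → Bool) → Set
  ClassClosed P = ∀ u v → u ~ v → P u ≡ P v

  colourClass-closed : ∀ z → ClassClosed (λ w → E w z)
  colourClass-closed = E-respˡ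

  equitable : ∀ u v → u ~ v → ∀ z → count (λ w → A u w ∧ E w z) ≡ count (λ w → A v w ∧ E w z)
  equitable u v u~v = U.sameColour⇒neighbourCount K u v (stable u v u~v)

  -- A class-closed set is a disjoint union of colour classes; peel them off one at a time.
  closed-neighbours : ∀ P → ClassClosed P → ∀ u v → u ~ v → count (λ w → A u w ∧ P w) ≡ count (λ w → A v w ∧ P w)
  closed-neighbours P closed = peel (count P) P closed ≤-refl
    where
    peel : ∀ fuel P → ClassClosed P → count P ≤ fuel → ∀ u v → u ~ v → count (λ w → A u w ∧ P w) ≡ count (λ w → A v w ∧ P w)
    peel fuel P closed size u v u~v with count P in c
    ... | zero = trans (count-≡0 (none u)) (sym (count-≡0 (none v)))
      where
      none : ∀ u w → (A u w ∧ P w) ≡ false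
      none u w = trans (cong (A u w ∧_) (count≡0⇒false P c w)) (∧-zeroʳ _)
    peel zero P closed size u v u~v | suc _ = ⊥-elim (n≮0 size)
    peel (suc fuel) P closed size u v u~v | suc _ with count>0⇒witness P (subst (1 ≤_) (sym c) (s≤s z≤n))
    ... | z , z∈P = begin
      count (λ w → A u w ∧ P w)                                        ≡⟨ split u ⟩
      count (λ w → A u w ∧ E w z) + count (λ w → A u w ∧ P′ w)          ≡⟨ cong₂ _+_ (equitable u v u~v z) rest ⟩
      count (λ w → A v w ∧ E w z) + count (λ w → A v w ∧ P′ w)          ≡⟨ sym (split v) ⟩
      count (λ w → A v w ∧ P w)                                        ∎
      where
      open ≡-Reasoning
      P′ : V → Bool
      P′ w = P w ∧ not (E w z)
      P′-closed : ClassClosed P′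
      P′-closed a b a~b = cong₂ (λ s t → s ∧ not t) (closed a b a~b) (colourClass-closed z a b a~b)
      P′-size : count P′ ≤ fuel
      P′-size = ≤-pred (≤-trans (count-< P′ P (λ w p → ∧-conicalˡ (P w) _ p) z
                                   (trans (cong (λ t → P z ∧ not t) (~-refl z)) (∧-zeroʳ _)) z∈P)
                                 (subst (_≤ suc fuel) (sym c) size))
      rest : count (λ w → A u w ∧ P′ w) ≡ count (λ w → A v w ∧ P′ w)
      rest = peel fuel P′ P′-closed P′-size u v u~v
      class⊆P : ∀ a w → (A a w ∧ P w) ∧ E w z ≡ A a w ∧ E w z
      class⊆P a w with bool-cases (E w z)
      ... | inj₁ w~z rewrite w~z | closed w z w~z | z∈P = ∧-identityʳ _
      ... | inj₂ w≁z rewrite w≁z = trans (∧-zeroʳ _) (sym (∧-zeroʳ _))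
      split : ∀ a → count (λ w → A a w ∧ P w) ≡ count (λ w → A a w ∧ E w z) + count (λ w → A a w ∧ P′ w)
      split a = trans (count-split _ (λ w → E w z))
                      (cong₂ _+_ (count-cong (class⊆P a)) (count-cong (λ w → ∧-assoc (A a w) (P w) _)))

  transfer : ∀ P → ClassClosed P → ∀ x y → inG x ~ inH y →
             count (λ w → adj G x w ∧ P (inG w)) ≡ count (λ w → adj H y w ∧ P (inH w))
  transfer P closed x y x~y = trans (sym (neighbours-inG x P)) (trans (closed-neighbours P closed _ _ x~y) (neighbours-inH y P))

  classSize : V → ℕ
  classSize z = count (λ x → E (inG x) z)

  classSize-resp : ∀ u v → u ~ v → classSize u ≡ classSize v
  classSize-resp u v u~v = count-cong (λ x → E-respʳ (inG x) u v u~v)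

  balanced : ∀ z → classSize z ≡ count (λ y → E (inH y) z)
  balanced z = trans (count-cong (λ x → E-respˡ z _ _ (proj₂ same x))) (count-permute (proj₁ same) (λ y → E (inH y) z))

  nonSingleton : V → Bool
  nonSingleton u = does (2 ≤? classSize u)

  nonSingleton-closed : ClassClosed nonSingleton
  nonSingleton-closed u v u~v = cong (λ s → does (2 ≤? s)) (classSize-resp u v u~v)

  singleton-adjacency : ∀ z → nonSingleton (inG z) ≡ false → ∀ z′ → inG z ~ inH z′ →
                        ∀ x y → inG x ~ inH y → adj H y z′ ≡ adj G x z
  singleton-adjacency z singleton z′ z~z′ x y x~y = sym (indicator-injective (begin
    indicator (adj G x z)                               ≡⟨ sym (count-single (adj G x) z) ⟩
    count (λ w → adj G x w ∧ (w == z))            ≡⟨ sym (count-cong (λ w → cong (adj G x w ∧_) (inG-member w))) ⟩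
    count (λ w → adj G x w ∧ E (inG w) (inG z))   ≡⟨ transfer (λ w → E w (inG z)) (colourClass-closed (inG z)) x y x~y ⟩
    count (λ w → adj H y w ∧ E (inH w) (inG z))   ≡⟨ count-cong (λ w → cong (adj H y w ∧_) (inH-member w)) ⟩
    count (λ w → adj H y w ∧ (w == z′))           ≡⟨ count-single (adj H y) z′ ⟩
    indicator (adj H y z′)                              ∎))
    where
    open ≡-Reasoning
    size≡1 : classSize (inG z) ≡ 1
    size≡1 = ≤-antisym (≤-pred (≰⇒> (does-false⇒ (2 ≤? classSize (inG z)) singleton))) (count>0 _ z (~-refl (inG z)))
    inG-member : ∀ w → E (inG w) (inG z) ≡ (w == z)
    inG-member = count≡1⇒≗== _ z size≡1 (~-refl (inG z))
    inH-member : ∀ w → E (inH w) (inG z) ≡ (w == z′)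
    inH-member = count≡1⇒≗== _ z′ (trans (sym (balanced (inG z))) size≡1) (~-sym _ _ z~z′)

  record PartialIso (alive : V → Bool) : Set where
    field
      f        : Fin (n G) → Fin (n H)
      h        : Fin (n H) → Fin (n G)
      f-colour : ∀ x → alive (inG x) ≡ true → inG x ~ inH (f x)
      h-colour : ∀ y → alive (inH y) ≡ true → inG (h y) ~ inH y
      h∘f      : ∀ x → alive (inG x) ≡ true → h (f x) ≡ x
      f∘h      : ∀ y → alive (inH y) ≡ true → f (h y) ≡ y
      f-adj    : ∀ x x′ → alive (inG x) ≡ true → alive (inG x′) ≡ true → adj H (f x) (f x′) ≡ adj G x x′

  _∖class_ : (V → Bool) → V → V → Bool
  (alive ∖class c) u = alive u ∧ not (E u c)

  ∖class-intro : ∀ alive c u → alive u ≡ true → E u c ≡ false → (alive ∖class c) u ≡ true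
  ∖class-intro alive c u a u≁c = ∧-intro a (cong not u≁c)

  ∖class-closed : ∀ alive c → ClassClosed alive → ClassClosed (alive ∖class c)
  ∖class-closed alive c closed u v u~v = cong₂ (λ s t → s ∧ not t) (closed u v u~v) (colourClass-closed c u v u~v)

  record ClassMatch (alive : V → Bool) (c : V) (P : PartialIso (alive ∖class c)) : Set where
    open PartialIso P
    field
      g         : Fin (n G) → Fin (n H)
      k         : Fin (n H) → Fin (n G)
      g-class   : ∀ x → inG x ~ c → inH (g x) ~ c
      k-class   : ∀ y → inH y ~ c → inG (k y) ~ c
      k∘g       : ∀ x → inG x ~ c → k (g x) ≡ x
      g∘k       : ∀ y → inH y ~ c → g (k y) ≡ y
      adj-rest  : ∀ x z → inG x ~ c → (alive ∖class c) (inG z) ≡ true → adj H (g x) (f z) ≡ adj G x z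
      adj-class : ∀ x x′ → inG x ~ c → inG x′ ~ c → adj H (g x) (g x′) ≡ adj G x x′

  module Extension (alive : V → Bool) (c : V) (P : PartialIso (alive ∖class c)) (match : ClassMatch alive c P) where
    open PartialIso P
    open ClassMatch match

    f′ : Fin (n G) → Fin (n H)
    f′ x = if E (inG x) c then g x else f x

    h′ : Fin (n H) → Fin (n G)
    h′ y = if E (inH y) c then k y else h y

    f′-in : ∀ x → inG x ~ c → f′ x ≡ g x
    f′-in x p rewrite p = refl

    f′-out : ∀ x → E (inG x) c ≡ false → f′ x ≡ f x
    f′-out x p rewrite p = refl

    h′-in : ∀ y → inH y ~ c → h′ y ≡ k y
    h′-in y p rewrite p = refl

    h′-out : ∀ y → E (inH y) c ≡ false → h′ y ≡ h y
    h′-out y p rewrite p = refl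

    f-outside : ∀ x → alive (inG x) ≡ true → E (inG x) c ≡ false → E (inH (f x)) c ≡ false
    f-outside x a p = trans (sym (colourClass-closed c _ _ (f-colour x (∖class-intro alive c _ a p)))) p

    h-outside : ∀ y → alive (inH y) ≡ true → E (inH y) c ≡ false → E (inG (h y)) c ≡ false
    h-outside y a p = trans (colourClass-closed c _ _ (h-colour y (∖class-intro alive c _ a p))) p

    f′-colour : ∀ x → alive (inG x) ≡ true → inG x ~ inH (f′ x)
    f′-colour x a with bool-cases (E (inG x) c)
    ... | inj₁ p rewrite f′-in x p = ~-trans _ c _ p (~-sym _ c (g-class x p))
    ... | inj₂ p rewrite f′-out x p = f-colour x (∖class-intro alive c _ a p)

    h′-colour : ∀ y → alive (inH y) ≡ true → inG (h′ y) ~ inH y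
    h′-colour y a with bool-cases (E (inH y) c)
    ... | inj₁ p rewrite h′-in y p = ~-trans _ c _ (k-class y p) (~-sym _ c p)
    ... | inj₂ p rewrite h′-out y p = h-colour y (∖class-intro alive c _ a p)

    h′∘f′ : ∀ x → alive (inG x) ≡ true → h′ (f′ x) ≡ x
    h′∘f′ x a with bool-cases (E (inG x) c)
    ... | inj₁ p rewrite f′-in x p | h′-in (g x) (g-class x p) = k∘g x p
    ... | inj₂ p rewrite f′-out x p | h′-out (f x) (f-outside x a p) = h∘f x (∖class-intro alive c _ a p)

    f′∘h′ : ∀ y → alive (inH y) ≡ true → f′ (h′ y) ≡ y
    f′∘h′ y a with bool-cases (E (inH y) c)
    ... | inj₁ p rewrite h′-in y p | f′-in (k y) (k-class y p) = g∘k y p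
    ... | inj₂ p rewrite h′-out y p | f′-out (h y) (h-outside y a p) = f∘h y (∖class-intro alive c _ a p)

    f′-adj : ∀ x x′ → alive (inG x) ≡ true → alive (inG x′) ≡ true → adj H (f′ x) (f′ x′) ≡ adj G x x′
    f′-adj x x′ a a′ with bool-cases (E (inG x) c) | bool-cases (E (inG x′) c)
    ... | inj₁ p | inj₁ p′ rewrite f′-in x p | f′-in x′ p′ = adj-class x x′ p p′
    ... | inj₁ p | inj₂ p′ rewrite f′-in x p | f′-out x′ p′ = adj-rest x x′ p (∖class-intro alive c _ a′ p′)
    ... | inj₂ p | inj₁ p′ rewrite f′-out x p | f′-in x′ p′ =
      trans (Graph.sym H (f x) (g x′)) (trans (adj-rest x′ x p′ (∖class-intro alive c _ a p)) (Graph.sym G x′ x))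
    ... | inj₂ p | inj₂ p′ rewrite f′-out x p | f′-out x′ p′ =
      f-adj x x′ (∖class-intro alive c _ a p) (∖class-intro alive c _ a′ p′)

    extend : PartialIso alive
    extend = record
      { f = f′ ; h = h′ ; f-colour = f′-colour ; h-colour = h′-colour ; h∘f = h′∘f′ ; f∘h = f′∘h′ ; f-adj = f′-adj }

  pending : (V → Bool) → V → Bool
  pending alive u = alive u ∧ nonSingleton u

  pending-closed : ∀ alive → ClassClosed alive → ClassClosed (pending alive)
  pending-closed alive closed u v u~v = cong₂ _∧_ (closed u v u~v) (nonSingleton-closed u v u~v)

  pendingDegree : (V → Bool) → Fin (n G) → ℕ
  pendingDegree alive x = count (λ w → adj G x w ∧ pending alive (inG w))

  PendingLeaf : (V → Bool) → Fin (n G) → Set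
  PendingLeaf alive x₀ = pendingDegree alive x₀ ≡ 0 ⊎ (pendingDegree alive x₀ ≡ 1 × nonSingleton (inG x₀) ≡ true)

  module ClassStep (alive : V → Bool) (alive-closed : ClassClosed alive)
                   (x₀ : Fin (n G)) (x₀-alive : alive (inG x₀) ≡ true)
                   (P : PartialIso (alive ∖class inG x₀)) where
    open PartialIso P

    c : V
    c = inG x₀

    inClassG : Fin (n G) → Bool
    inClassG x = E (inG x) c

    inClassH : Fin (n H) → Bool
    inClassH y = E (inH y) c

    alive′ : V → Bool
    alive′ = alive ∖class c

    pendingInG : Fin (n G) → Bool
    pendingInG x = pending alive (inG x)

    pendingInH : Fin (n H) → Bool
    pendingInH y = pending alive (inH y)

    classDegree : (V → Bool) → ℕ
    classDegree Q = count (λ w → adj G x₀ w ∧ Q (inG w))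

    classDegree-G : ∀ Q → ClassClosed Q → ∀ x → inClassG x ≡ true → count (λ w → adj G x w ∧ Q (inG w)) ≡ classDegree Q
    classDegree-G Q closed x x~c = trans (sym (neighbours-inG x Q)) (trans (closed-neighbours Q closed _ _ x~c) (neighbours-inG x₀ Q))

    classDegree-H : ∀ Q → ClassClosed Q → ∀ y → inClassH y ≡ true → count (λ w → adj H y w ∧ Q (inH w)) ≡ classDegree Q
    classDegree-H Q closed y y~c = trans (sym (neighbours-inH y Q)) (trans (closed-neighbours Q closed _ _ y~c) (neighbours-inG x₀ Q))

    pendingDeg : ℕ
    pendingDeg = pendingDegree alive x₀

    innerDeg : ℕ
    innerDeg = classDegree (λ u → E u c)

    class-alive : ∀ u → u ~ c → alive u ≡ true
    class-alive u u~c = trans (alive-closed u c u~c) x₀-alive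

    class-pending : nonSingleton c ≡ true → ∀ u → u ~ c → pending alive u ≡ true
    class-pending ns u u~c = ∧-intro (class-alive u u~c) (trans (nonSingleton-closed u c u~c) ns)

    alive′-outside : ∀ u → alive′ u ≡ true → E u c ≡ false
    alive′-outside u a = not-true⇒false (∧-conicalʳ (alive u) _ a)

    f-alive′ : ∀ z → alive′ (inG z) ≡ true → alive′ (inH (f z)) ≡ true
    f-alive′ z a = trans (sym (∖class-closed alive c alive-closed _ _ (f-colour z a))) a

    f-pending : ∀ z → alive′ (inG z) ≡ true → nonSingleton (inG z) ≡ true → pendingInH (f z) ≡ true
    f-pending z a ns = ∧-intro (∧-conicalˡ _ _ (f-alive′ z a)) (trans (sym (nonSingleton-closed _ _ (f-colour z a))) ns)

    PendingAdjacency : (Fin (n G) → Fin (n H)) → Set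
    PendingAdjacency g =
      ∀ x z → inClassG x ≡ true → alive′ (inG z) ≡ true → nonSingleton (inG z) ≡ true → adj H (g x) (f z) ≡ adj G x z

    InnerAdjacency : (Fin (n G) → Fin (n H)) → Set
    InnerAdjacency g = ∀ x x′ → inClassG x ≡ true → inClassG x′ ≡ true → adj H (g x) (g x′) ≡ adj G x x′

    adj-singleton : ∀ x z → inClassG x ≡ true → alive′ (inG z) ≡ true → nonSingleton (inG z) ≡ false →
                    ∀ y → inClassH y ≡ true → adj H y (f z) ≡ adj G x z
    adj-singleton x z x~c a singleton y y~c =
      singleton-adjacency z singleton (f z) (f-colour z a) x y (~-trans (inG x) c (inH y) x~c (~-sym _ _ y~c))

    module FromMatching {r fixed} {ιA : Fin (n G) → Fin (n G)} {ιB : Fin (n H) → Fin (n H)}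
                        {tA : Fin (n G) → Fin r} {tB : Fin (n H) → Fin r}
                        (matching : OrbitMatching.Matching fixed ιA ιB tA tB inClassG inClassH) where
      open OrbitMatching.Matching matching

      classMatch : PendingAdjacency g → InnerAdjacency g → ClassMatch alive c P
      classMatch adj-pending adj-class = record
        { g = g ; k = k ; g-class = g∈B ; k-class = k∈A ; k∘g = k∘g ; g∘k = g∘k
        ; adj-rest = adj-rest ; adj-class = adj-class }
        where
        adj-rest : ∀ x z → inClassG x ≡ true → alive′ (inG z) ≡ true → adj H (g x) (f z) ≡ adj G x z
        adj-rest x z x~c a with bool-cases (nonSingleton (inG z))
        ... | inj₁ ns        = adj-pending x z x~c a ns
        ... | inj₂ singleton = adj-singleton x z x~c a singleton (g x) (g∈B x x~c)

    matchOn : ∀ {r} fixed {ιA ιB} (tA : Fin (n G) → Fin r) (tB : Fin (n H) → Fin r) →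
              OrbitMatching.Orbits fixed ιA tA inClassG → OrbitMatching.Orbits fixed ιB tB inClassH →
              (∀ s → OrbitMatching.typeCount fixed tA inClassG s ≡ OrbitMatching.typeCount fixed tB inClassH s) →
              OrbitMatching.Matching fixed ιA ιB tA tB inClassG inClassH
    matchOn fixed tA tB OA OB counts = OrbitMatching.matching fixed f h (count inClassG) ≤-refl OA OB counts

    T-closed : ClassClosed (pending alive)
    T-closed = pending-closed alive alive-closed

    alive′-pending : ∀ z → alive′ (inG z) ≡ true → nonSingleton (inG z) ≡ true → pendingInG z ≡ true
    alive′-pending z a ns = ∧-intro (∧-conicalˡ (alive (inG z)) _ a) ns

    no-neighbours : ∀ Q → ClassClosed Q → classDegree Q ≡ 0 → ∀ x y → inClassG x ≡ true → inClassH y ≡ true →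
                    ∀ z z′ → Q (inG z) ≡ true → Q (inH z′) ≡ true → adj H y z′ ≡ adj G x z
    no-neighbours Q closed d≡0 x y x~c y~c z z′ z∈Q z′∈Q =
      trans (count-∧≡0 (adj H y) (λ w → Q (inH w)) (trans (classDegree-H Q closed y y~c) d≡0) z′ z′∈Q)
            (sym (count-∧≡0 (adj G x) (λ w → Q (inG w)) (trans (classDegree-G Q closed x x~c) d≡0) z z∈Q))

    innerDeg≤pendingDeg : nonSingleton c ≡ true → innerDeg ≤ pendingDeg
    innerDeg≤pendingDeg ns =
      count-mono _ _ (λ w p → ∧-intro (∧-conicalˡ (adj G x₀ w) _ p) (class-pending ns (inG w) (∧-conicalʳ (adj G x₀ w) _ p)))

    -- The class lies in the pending set, or it is {x₀}.
    pendingDeg≡0⇒innerDeg≡0 : pendingDeg ≡ 0 → innerDeg ≡ 0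
    pendingDeg≡0⇒innerDeg≡0 pendingDeg≡0 with bool-cases (nonSingleton c)
    ... | inj₁ ns        = n≤0⇒n≡0 (≤-trans (innerDeg≤pendingDeg ns) (≤-reflexive pendingDeg≡0))
    ... | inj₂ singleton = begin
      count (λ w → adj G x₀ w ∧ inClassG w)  ≡⟨ count-cong (λ w → cong (adj G x₀ w ∧_) (class≡x₀ w)) ⟩
      count (λ w → adj G x₀ w ∧ (w == x₀))   ≡⟨ count-single (adj G x₀) x₀ ⟩
      indicator (adj G x₀ x₀)                ≡⟨ cong indicator (Graph.irrefl G x₀) ⟩
      0                                      ∎
      where
      open ≡-Reasoning
      class≡x₀ : ∀ w → inClassG w ≡ (w == x₀)
      class≡x₀ = count≡1⇒≗== inClassG x₀ (≤-antisym (≤-pred (≰⇒> (does-false⇒ (2 ≤? classSize c) singleton)))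
                                                    (count>0 inClassG x₀ (~-refl c)))
                             (~-refl c)

    isolatedClass : pendingDeg ≡ 0 → ClassMatch alive c P
    isolatedClass pendingDeg≡0 = FromMatching.classMatch classMatching adj-pending adj-class
      where
      classMatching : OrbitMatching.Matching true (λ x → x) (λ y → y) (λ _ → x₀) (λ _ → x₀) inClassG inClassH
      classMatching = matchOn true (λ _ → x₀) (λ _ → x₀) (identityOrbits _ inClassG) (identityOrbits _ inClassH)
                              (constant-typeCounts true x₀ inClassG inClassH (balanced c))
      open OrbitMatching.Matching classMatching
      adj-pending : PendingAdjacency g
      adj-pending x z x~c a ns =
        no-neighbours (pending alive) T-closed pendingDeg≡0 x (g x) x~c (g∈B x x~c) z (f z) (alive′-pending z a ns) (f-pending z a ns)
      adj-class : InnerAdjacency g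
      adj-class x x′ x~c x′~c = no-neighbours (λ u → E u c) (colourClass-closed c) (pendingDeg≡0⇒innerDeg≡0 pendingDeg≡0)
                                              x (g x) x~c (g∈B x x~c) x′ (g x′) x′~c (g∈B x′ x′~c)

    module UniquePendingNeighbour (pendingDeg≡1 : pendingDeg ≡ 1) where

      degreeG : ∀ x → inClassG x ≡ true → count (λ w → adj G x w ∧ pendingInG w) ≡ 1
      degreeG x x~c = trans (classDegree-G (pending alive) T-closed x x~c) pendingDeg≡1

      degreeH : ∀ y → inClassH y ≡ true → count (λ w → adj H y w ∧ pendingInH w) ≡ 1
      degreeH y y~c = trans (classDegree-H (pending alive) T-closed y y~c) pendingDeg≡1

      p : Fin (n G) → Fin (n G)
      p x = choose (λ w → adj G x w ∧ pendingInG w) x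

      q : Fin (n H) → Fin (n H)
      q y = choose (λ w → adj H y w ∧ pendingInH w) y

      p-spec : ∀ x → inClassG x ≡ true → (adj G x (p x) ∧ pendingInG (p x)) ≡ true
      p-spec x x~c = choose-spec _ x (≤-reflexive (sym (degreeG x x~c)))

      q-spec : ∀ y → inClassH y ≡ true → (adj H y (q y) ∧ pendingInH (q y)) ≡ true
      q-spec y y~c = choose-spec _ y (≤-reflexive (sym (degreeH y y~c)))

      p-adj : ∀ x → inClassG x ≡ true → adj G x (p x) ≡ true
      p-adj x x~c = ∧-conicalˡ _ _ (p-spec x x~c)

      q-adj : ∀ y → inClassH y ≡ true → adj H y (q y) ≡ true
      q-adj y y~c = ∧-conicalˡ _ _ (q-spec y y~c)

      p-unique : ∀ x → inClassG x ≡ true → ∀ w → adj G x w ≡ true → pendingInG w ≡ true → w ≡ p x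
      p-unique x x~c w e t = count≡1⇒unique _ (degreeG x x~c) w (p x) (∧-intro e t) (p-spec x x~c)

      q-unique : ∀ y → inClassH y ≡ true → ∀ w → adj H y w ≡ true → pendingInH w ≡ true → w ≡ q y
      q-unique y y~c w e t = count≡1⇒unique _ (degreeH y y~c) w (q y) (∧-intro e t) (q-spec y y~c)

      -- innerDeg ≡ 1: the pending neighbour lies in the class itself, so p and q are perfect matchings of the class.
      module PairedClass (ns : nonSingleton c ≡ true) (innerDeg≡1 : innerDeg ≡ 1) where

        p-class : ∀ x → inClassG x ≡ true → inClassG (p x) ≡ true
        p-class x x~c with count>0⇒witness (λ w → adj G x w ∧ inClassG w)
                             (≤-reflexive (sym (trans (classDegree-G (λ u → E u c) (colourClass-closed c) x x~c) innerDeg≡1)))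
        ... | w , e = subst (λ v → inClassG v ≡ true) (p-unique x x~c w (∧-conicalˡ _ _ e) (class-pending ns (inG w) w~c)) w~c
          where
          w~c : inClassG w ≡ true
          w~c = ∧-conicalʳ (adj G x w) _ e

        q-class : ∀ y → inClassH y ≡ true → inClassH (q y) ≡ true
        q-class y y~c with count>0⇒witness (λ w → adj H y w ∧ inClassH w)
                             (≤-reflexive (sym (trans (classDegree-H (λ u → E u c) (colourClass-closed c) y y~c) innerDeg≡1)))
        ... | w , e = subst (λ v → inClassH v ≡ true) (q-unique y y~c w (∧-conicalˡ _ _ e) (class-pending ns (inH w) w~c)) w~c
          where
          w~c : inClassH w ≡ true
          w~c = ∧-conicalʳ (adj H y w) _ e

        p-orbits : OrbitMatching.Orbits false p (λ _ → x₀) inClassG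
        p-orbits = record
          { closed     = p-class
          ; involutive = λ x x~c → sym (p-unique (p x) (p-class x x~c) x (trans (Graph.sym G (p x) x) (p-adj x x~c))
                                                 (class-pending ns (inG x) x~c))
          ; type-ι     = λ _ _ → refl
          ; fixed-ι    = λ x x~c → ≢⇒==false (≢-sym (adj⇒≢ G (p-adj x x~c)))
          }

        q-orbits : OrbitMatching.Orbits false q (λ _ → x₀) inClassH
        q-orbits = record
          { closed     = q-class
          ; involutive = λ y y~c → sym (q-unique (q y) (q-class y y~c) y (trans (Graph.sym H (q y) y) (q-adj y y~c))
                                                 (class-pending ns (inH y) y~c))
          ; type-ι     = λ _ _ → refl
          ; fixed-ι    = λ y y~c → ≢⇒==false (≢-sym (adj⇒≢ H (q-adj y y~c)))
          }

        classMatching : OrbitMatching.Matching false p q (λ _ → x₀) (λ _ → x₀) inClassG inClassH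
        classMatching = matchOn false (λ _ → x₀) (λ _ → x₀) p-orbits q-orbits
                                (constant-typeCounts false x₀ inClassG inClassH (balanced c))

        open OrbitMatching.Matching classMatching

        adj-pending : PendingAdjacency g
        adj-pending x z x~c a ns′ = trans (no-edge-H (bool-cases _)) (sym (no-edge-G (bool-cases _)))
          where
          no-edge-G : adj G x z ≡ true ⊎ adj G x z ≡ false → adj G x z ≡ false
          no-edge-G (inj₂ e) = e
          no-edge-G (inj₁ e) = ⊥-elim (≡true⇒≢false z~c (alive′-outside _ a))
            where
            z~c : inClassG z ≡ true
            z~c = subst (λ v → inClassG v ≡ true) (sym (p-unique x x~c z e (alive′-pending z a ns′))) (p-class x x~c)
          no-edge-H : adj H (g x) (f z) ≡ true ⊎ adj H (g x) (f z) ≡ false → adj H (g x) (f z) ≡ false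
          no-edge-H (inj₂ e) = e
          no-edge-H (inj₁ e) = ⊥-elim (≡true⇒≢false fz~c (alive′-outside _ (f-alive′ z a)))
            where
            fz~c : inClassH (f z) ≡ true
            fz~c = subst (λ v → inClassH v ≡ true) (sym (q-unique (g x) (g∈B x x~c) (f z) e (f-pending z a ns′)))
                         (q-class (g x) (g∈B x x~c))

        adj-class : InnerAdjacency g
        adj-class x x′ x~c x′~c = bool-ext H⇒G G⇒H
          where
          G⇒H : adj G x x′ ≡ true → adj H (g x) (g x′) ≡ true
          G⇒H e = subst (λ v → adj H (g x) v ≡ true)
                        (sym (trans (cong g (p-unique x x~c x′ e (class-pending ns (inG x′) x′~c))) (g-ι x x~c)))
                        (q-adj (g x) (g∈B x x~c))
          H⇒G : adj H (g x) (g x′) ≡ true → adj G x x′ ≡ true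
          H⇒G e = subst (λ v → adj G x v ≡ true) (sym x′≡px) (p-adj x x~c)
            where
            gx′≡qgx : g x′ ≡ q (g x)
            gx′≡qgx = q-unique (g x) (g∈B x x~c) (g x′) e (class-pending ns (inH (g x′)) (g∈B x′ x′~c))
            x′≡px : x′ ≡ p x
            x′≡px = begin
              x′            ≡⟨ sym (k∘g x′ x′~c) ⟩
              k (g x′)      ≡⟨ cong k (trans gx′≡qgx (sym (g-ι x x~c))) ⟩
              k (g (p x))   ≡⟨ k∘g (p x) (p-class x x~c) ⟩
              p x           ∎
              where open ≡-Reasoning

        classMatch : ClassMatch alive c P
        classMatch = FromMatching.classMatch classMatching adj-pending adj-class

      -- innerDeg ≡ 0: the pending neighbour of a class vertex lies outside the class, so the matching must respect it:
      -- it is typed by p on the G-side and by h ∘ q on the H-side.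
      module OuterClass (innerDeg≡0 : innerDeg ≡ 0) where

        no-inner-G : ∀ x → inClassG x ≡ true → ∀ w → inClassG w ≡ true → adj G x w ≡ false
        no-inner-G x x~c = count-∧≡0 (adj G x) inClassG (trans (classDegree-G (λ u → E u c) (colourClass-closed c) x x~c) innerDeg≡0)

        no-inner-H : ∀ y → inClassH y ≡ true → ∀ w → inClassH w ≡ true → adj H y w ≡ false
        no-inner-H y y~c = count-∧≡0 (adj H y) inClassH (trans (classDegree-H (λ u → E u c) (colourClass-closed c) y y~c) innerDeg≡0)

        q-alive′ : ∀ y → inClassH y ≡ true → alive′ (inH (q y)) ≡ true
        q-alive′ y y~c with bool-cases (inClassH (q y))
        ... | inj₁ inner = ⊥-elim (≡true⇒≢false (q-adj y y~c) (no-inner-H y y~c (q y) inner))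
        ... | inj₂ outer = ∖class-intro alive c _ (∧-conicalˡ _ _ (∧-conicalʳ (adj H y (q y)) _ (q-spec y y~c))) outer

        outer : Fin (n G) → Bool
        outer t = alive′ (inG t) ∧ nonSingleton (inG t)

        p-== : ∀ x → inClassG x ≡ true → ∀ t → (p x == t) ≡ (adj G x t ∧ pendingInG t)
        p-== x x~c t =
          bool-ext (λ px==t → subst (λ v → (adj G x v ∧ pendingInG v) ≡ true) (==⇒≡ px==t) (p-spec x x~c))
                   (λ e → subst (λ v → (v == t) ≡ true) (p-unique x x~c t (∧-conicalˡ _ _ e) (∧-conicalʳ (adj G x t) _ e)) (==-refl t))

        hq-outer : ∀ y → inClassH y ≡ true → outer (h (q y)) ≡ true
        hq-outer y y~c =
          ∧-intro (trans (∖class-closed alive c alive-closed _ _ hqy~qy) (q-alive′ y y~c))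
                  (trans (nonSingleton-closed _ _ hqy~qy) (∧-conicalʳ (alive (inH (q y))) _ (∧-conicalʳ (adj H y (q y)) _ (q-spec y y~c))))
          where
          hqy~qy : inG (h (q y)) ~ inH (q y)
          hqy~qy = h-colour (q y) (q-alive′ y y~c)

        hq-== : ∀ y → inClassH y ≡ true → ∀ t → (h (q y) == t) ≡ (outer t ∧ adj H y (f t))
        hq-== y y~c t = bool-ext ⇒ ⇐
          where
          ⇒ : (h (q y) == t) ≡ true → (outer t ∧ adj H y (f t)) ≡ true
          ⇒ hqy==t = subst (λ v → (outer v ∧ adj H y (f v)) ≡ true) (==⇒≡ hqy==t)
                           (∧-intro (hq-outer y y~c) (subst (λ v → adj H y v ≡ true) (sym (f∘h (q y) (q-alive′ y y~c))) (q-adj y y~c)))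
          ⇐ : (outer t ∧ adj H y (f t)) ≡ true → (h (q y) == t) ≡ true
          ⇐ e = subst (λ v → (h v == t) ≡ true) (q-unique y y~c (f t) (∧-conicalʳ (outer t) _ e) (f-pending t t-alive′ t-ns))
                      (subst (λ v → (v == t) ≡ true) (sym (h∘f t t-alive′)) (==-refl t))
            where
            t-alive′ : alive′ (inG t) ≡ true
            t-alive′ = ∧-conicalˡ _ _ (∧-conicalˡ (outer t) _ e)
            t-ns : nonSingleton (inG t) ≡ true
            t-ns = ∧-conicalʳ (alive′ (inG t)) _ (∧-conicalˡ (outer t) _ e)

        typeCount-outer : ∀ t → outer t ≡ true →
                          count (λ x → inClassG x ∧ (adj G x t ∧ pendingInG t)) ≡ count (λ y → inClassH y ∧ (outer t ∧ adj H y (f t)))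
        typeCount-outer t t-outer = begin
          count (λ x → inClassG x ∧ (adj G x t ∧ pendingInG t))
            ≡⟨ count-cong (λ x → cong (λ b → inClassG x ∧ (adj G x t ∧ b)) t-pending) ⟩
          count (λ x → inClassG x ∧ (adj G x t ∧ true))
            ≡⟨ count-cong (λ x → trans (cong (inClassG x ∧_) (∧-identityʳ _))
                                       (trans (∧-comm (inClassG x) _) (cong (_∧ inClassG x) (Graph.sym G x t)))) ⟩
          count (λ x → adj G t x ∧ inClassG x)
            ≡⟨ transfer (λ u → E u c) (colourClass-closed c) t (f t) (f-colour t t-alive′) ⟩
          count (λ y → adj H (f t) y ∧ inClassH y)
            ≡⟨ count-cong (λ y → trans (∧-comm _ (inClassH y)) (cong (inClassH y ∧_) (Graph.sym H (f t) y))) ⟩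
          count (λ y → inClassH y ∧ adj H y (f t))
            ≡⟨ count-cong (λ y → cong (λ b → inClassH y ∧ (b ∧ adj H y (f t))) (sym t-outer)) ⟩
          count (λ y → inClassH y ∧ (outer t ∧ adj H y (f t)))
            ∎
          where
          open ≡-Reasoning
          t-alive′ : alive′ (inG t) ≡ true
          t-alive′ = ∧-conicalˡ _ _ t-outer
          t-pending : pendingInG t ≡ true
          t-pending = alive′-pending t t-alive′ (∧-conicalʳ (alive′ (inG t)) _ t-outer)

        -- A pending vertex that is no longer alive′ lies in the class, which has no inner edges.
        typeCount-inner : ∀ t → outer t ≡ false → ∀ x → (inClassG x ∧ (adj G x t ∧ pendingInG t)) ≡ false
        typeCount-inner t t-inner x with bool-cases (inClassG x) | bool-cases (pendingInG t)
        ... | inj₂ x≁c | _           = cong (_∧ (adj G x t ∧ pendingInG t)) x≁c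
        ... | inj₁ x~c | inj₂ t-done =
          trans (cong (λ b → inClassG x ∧ (adj G x t ∧ b)) t-done) (trans (cong (inClassG x ∧_) (∧-zeroʳ _)) (∧-zeroʳ _))
        ... | inj₁ x~c | inj₁ t-pend =
          trans (cong (λ b → inClassG x ∧ (b ∧ pendingInG t)) (no-inner-G x x~c t t~c)) (∧-zeroʳ (inClassG x))
          where
          t~c : inClassG t ≡ true
          t~c with bool-cases (inClassG t)
          ... | inj₁ r = r
          ... | inj₂ r = ⊥-elim (≡true⇒≢false (∧-intro (∖class-intro alive c _ (∧-conicalˡ _ _ t-pend) r)
                                                        (∧-conicalʳ (alive (inG t)) _ t-pend))
                                               t-inner)

        typeCounts : ∀ t → OrbitMatching.typeCount true p inClassG t ≡ OrbitMatching.typeCount true (λ y → h (q y)) inClassH t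
        typeCounts t = begin
          count (λ x → inClassG x ∧ (p x == t))
            ≡⟨ count-cong (λ x → ∧-congˡ-if (inClassG x) (λ x~c → p-== x x~c t)) ⟩
          count (λ x → inClassG x ∧ (adj G x t ∧ pendingInG t))
            ≡⟨ by-outer (bool-cases (outer t)) ⟩
          count (λ y → inClassH y ∧ (outer t ∧ adj H y (f t)))
            ≡⟨ sym (count-cong (λ y → ∧-congˡ-if (inClassH y) (λ y~c → hq-== y y~c t))) ⟩
          count (λ y → inClassH y ∧ (h (q y) == t))
            ∎
          where
          open ≡-Reasoning
          by-outer : outer t ≡ true ⊎ outer t ≡ false →
                     count (λ x → inClassG x ∧ (adj G x t ∧ pendingInG t)) ≡ count (λ y → inClassH y ∧ (outer t ∧ adj H y (f t)))
          by-outer (inj₁ t-outer) = typeCount-outer t t-outer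
          by-outer (inj₂ t-inner) =
            trans (count-≡0 (typeCount-inner t t-inner))
                  (sym (count-≡0 (λ y → trans (cong (λ b → inClassH y ∧ (b ∧ adj H y (f t))) t-inner) (∧-zeroʳ (inClassH y)))))

        classMatching : OrbitMatching.Matching true (λ x → x) (λ y → y) p (λ y → h (q y)) inClassG inClassH
        classMatching =
          matchOn true p (λ y → h (q y)) (identityOrbits p inClassG) (identityOrbits (λ y → h (q y)) inClassH) typeCounts

        open OrbitMatching.Matching classMatching

        adj-pending : PendingAdjacency g
        adj-pending x z x~c a ns′ = bool-ext H⇒G G⇒H
          where
          G⇒H : adj G x z ≡ true → adj H (g x) (f z) ≡ true
          G⇒H e = subst (λ v → adj H (g x) v ≡ true) (sym fz≡qgx) (q-adj (g x) (g∈B x x~c))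
            where
            fz≡qgx : f z ≡ q (g x)
            fz≡qgx = begin
              f z              ≡⟨ cong f (p-unique x x~c z e (alive′-pending z a ns′)) ⟩
              f (p x)          ≡⟨ cong f (sym (type-g x x~c)) ⟩
              f (h (q (g x)))  ≡⟨ f∘h (q (g x)) (q-alive′ (g x) (g∈B x x~c)) ⟩
              q (g x)          ∎
              where open ≡-Reasoning
          H⇒G : adj H (g x) (f z) ≡ true → adj G x z ≡ true
          H⇒G e = subst (λ v → adj G x v ≡ true) (sym z≡px) (p-adj x x~c)
            where
            z≡px : z ≡ p x
            z≡px = begin
              z                ≡⟨ sym (h∘f z a) ⟩
              h (f z)          ≡⟨ cong h (q-unique (g x) (g∈B x x~c) (f z) e (f-pending z a ns′)) ⟩
              h (q (g x))      ≡⟨ type-g x x~c ⟩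
              p x              ∎
              where open ≡-Reasoning

        adj-class : InnerAdjacency g
        adj-class x x′ x~c x′~c = trans (no-inner-H (g x) (g∈B x x~c) (g x′) (g∈B x′ x′~c)) (sym (no-inner-G x x~c x′ x′~c))

        classMatch : ClassMatch alive c P
        classMatch = FromMatching.classMatch classMatching adj-pending adj-class

    classMatch : PendingLeaf alive x₀ → ClassMatch alive c P
    classMatch (inj₁ pendingDeg≡0) = isolatedClass pendingDeg≡0
    classMatch (inj₂ (pendingDeg≡1 , ns)) with innerDeg in innerDeg≡ | innerDeg≤pendingDeg ns
    ... | zero        | _ = UniquePendingNeighbour.OuterClass.classMatch pendingDeg≡1 innerDeg≡
    ... | suc zero    | _ = UniquePendingNeighbour.PairedClass.classMatch pendingDeg≡1 ns innerDeg≡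
    ... | suc (suc _) | innerDeg≤1 = ⊥-elim (<⇒≱ (s≤s (s≤s z≤n)) (subst (_ ≤_) pendingDeg≡1 innerDeg≤1))

  stable-G : Stable G K
  stable-G x y x~y = trans (sym (eqCol-inG (suc K) x y)) (stable _ _ (trans (eqCol-inG K x y) x~y))

  module TwoCoreColours (S : VSet G) (core : IsTwoCore G S) where

    -- The colour saturation of S is class-closed and has minimum degree 2, so by maximality it is S itself.
    saturation : V → Bool
    saturation u = does (1 ≤? count (λ s → S s ∧ E u (inG s)))

    saturation-closed : ClassClosed saturation
    saturation-closed u v u~v = cong (λ m → does (1 ≤? m)) (count-cong (λ s → cong (S s ∧_) (E-respˡ (inG s) u v u~v)))

    S⊆saturation : ∀ x → S x ≡ true → saturation (inG x) ≡ true
    S⊆saturation x x∈S = dec-true (1 ≤? _) (count>0 _ x (∧-intro x∈S (~-refl (inG x))))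

    saturation-degree : ∀ x → degIn G (λ w → saturation (inG w)) x ≡ count (λ w → unionAdj G H (inG x) w ∧ saturation w)
    saturation-degree x = trans (count-cong (λ w → ∧-comm (saturation (inG w)) _)) (sym (neighbours-inG x saturation))

    saturation⊆S : ∀ x → saturation (inG x) ≡ true → S x ≡ true
    saturation⊆S = proj₂ core (λ w → saturation (inG w)) minimum-degree
      where
      minimum-degree : MinDeg2 G (λ w → saturation (inG w))
      minimum-degree x x∈sat with count>0⇒witness _ (does-true⇒ (1 ≤? _) x∈sat)
      ... | s , s∈S∧x~s = begin
        2                                                         ≤⟨ proj₁ core s (∧-conicalˡ (S s) _ s∈S∧x~s) ⟩
        degIn G S s                                               ≤⟨ count-mono _ _ (λ w p → ∧-intro (S⊆saturation w (∧-conicalˡ (S w) _ p)) (∧-conicalʳ (S w) _ p)) ⟩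
        degIn G (λ w → saturation (inG w)) s                      ≡⟨ saturation-degree s ⟩
        count (λ w → unionAdj G H (inG s) w ∧ saturation w)       ≡⟨ closed-neighbours saturation saturation-closed _ _ (~-sym _ _ (∧-conicalʳ (S s) _ s∈S∧x~s)) ⟩
        count (λ w → unionAdj G H (inG x) w ∧ saturation w)       ≡⟨ sym (saturation-degree x) ⟩
        degIn G (λ w → saturation (inG w)) x                      ∎
        where open ≤-Reasoning

    S≡saturation : ∀ x → S x ≡ saturation (inG x)
    S≡saturation x = bool-ext (S⊆saturation x) (saturation⊆S x)

    S-closed : ∀ x y → inG x ~ inG y → S x ≡ S y
    S-closed x y x~y = trans (S≡saturation x) (trans (saturation-closed _ _ x~y) (sym (S≡saturation y)))

    coreDegree-closed : ∀ x y → inG x ~ inG y → degIn G S x ≡ degIn G S y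
    coreDegree-closed x y x~y = begin
      degIn G S x                                         ≡⟨ as-union x ⟩
      count (λ w → unionAdj G H (inG x) w ∧ saturation w)  ≡⟨ closed-neighbours saturation saturation-closed _ _ x~y ⟩
      count (λ w → unionAdj G H (inG y) w ∧ saturation w)  ≡⟨ sym (as-union y) ⟩
      degIn G S y                                         ∎
      where
      open ≡-Reasoning
      as-union : ∀ x → degIn G S x ≡ count (λ w → unionAdj G H (inG x) w ∧ saturation w)
      as-union x = trans (count-cong (λ w → cong (_∧ adj G x w) (S≡saturation w))) (saturation-degree x)

    V23-closed : ∀ x y → inG x ~ inG y → InV23 G S y → InV23 G S x
    V23-closed x y x~y (y∈S , 3≤deg) = trans (S-closed x y x~y) y∈S , subst (3 ≤_) (sym (coreDegree-closed x y x~y)) 3≤deg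

    V23-singleton : (∀ k → Stable G k → ∀ u v → InV23 G S u → InV23 G S v → eqCol (adj G) k u v ≡ true → u ≡ v) →
                    ∀ x → InV23 G S x → classSize (inG x) ≡ 1
    V23-singleton discrete x x∈V23 = trans (count-cong only-x) (count-single (λ _ → true) x)
      where
      only-x : ∀ x′ → E (inG x′) (inG x) ≡ (true ∧ (x′ == x))
      only-x x′ = bool-ext (λ x′~x → subst (λ v → (x′ == v) ≡ true) (same-vertex x′~x) (==-refl x′))
                           (λ x′==x → subst (λ v → E (inG v) (inG x) ≡ true) (sym (==⇒≡ x′==x)) (~-refl (inG x)))
        where
        same-vertex : inG x′ ~ inG x → x′ ≡ x
        same-vertex x′~x = discrete K stable-G x′ x (V23-closed x′ x x′~x x∈V23) x∈V23 (trans (sym (eqCol-inG K x′ x)) x′~x)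

  module Construction (leaves : OneDegenerateOn G (λ x → 2 ≤ classSize (inG x))) where

    pending⇒nonSingleton : ∀ alive x → pending alive (inG x) ≡ true → 2 ≤ classSize (inG x)
    pending⇒nonSingleton alive x p = does-true⇒ (2 ≤? classSize (inG x)) (∧-conicalʳ (alive (inG x)) _ p)

    anchor : ∀ alive → 1 ≤ count (λ x → alive (inG x)) → ∃ λ x₀ → alive (inG x₀) ≡ true × PendingLeaf alive x₀
    anchor alive nonempty with count (λ x → pending alive (inG x)) in c
    ... | zero with count>0⇒witness _ nonempty
    ...   | x₀ , x₀-alive =
      x₀ , x₀-alive , inj₁ (count-≡0 (λ w → trans (cong (adj G x₀ w ∧_) (count≡0⇒false _ c w)) (∧-zeroʳ _)))
    anchor alive nonempty | suc _ with count>0⇒witness _ (subst (1 ≤_) (sym c) (s≤s z≤n))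
    ... | x₁ , x₁-pending with leaves (λ x → pending alive (inG x)) (pending⇒nonSingleton alive) x₁ x₁-pending
    ...   | x₀ , x₀-pending , degree≤1 = x₀ , ∧-conicalˡ _ _ x₀-pending , shape (≤-trans (≤-reflexive degree≡) degree≤1)
      where
      degree≡ : pendingDegree alive x₀ ≡ degIn G (λ x → pending alive (inG x)) x₀
      degree≡ = count-cong (λ w → ∧-comm (adj G x₀ w) _)
      shape : pendingDegree alive x₀ ≤ 1 → PendingLeaf alive x₀
      shape d≤1 with pendingDegree alive x₀
      ... | zero     = inj₁ refl
      ... | suc zero = inj₂ (refl , ∧-conicalʳ (alive (inG x₀)) _ x₀-pending)
      ... | suc (suc _) = ⊥-elim (<⇒≱ (s≤s (s≤s z≤n)) d≤1)

    partialIso : ∀ fuel alive → ClassClosed alive → count (λ x → alive (inG x)) ≤ fuel → PartialIso alive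
    partialIso fuel alive closed size with count (λ x → alive (inG x)) in c
    ... | zero = record
      { f = Inverse.to (proj₁ same) ; h = Inverse.from (proj₁ same)
      ; f-colour = λ x a → ⊥-elim (noG x a) ; h-colour = λ y a → ⊥-elim (noH y a)
      ; h∘f = λ x a → ⊥-elim (noG x a) ; f∘h = λ y a → ⊥-elim (noH y a)
      ; f-adj = λ x _ a _ → ⊥-elim (noG x a) }
      where
      noG : ∀ x → alive (inG x) ≢ true
      noG x a = ≡true⇒≢false a (count≡0⇒false _ c x)
      noH : ∀ y → alive (inH y) ≢ true
      noH y a with count>0⇒witness _ (subst (1 ≤_) (sym (balanced (inH y))) (count>0 _ y (~-refl (inH y))))
      ... | x , x~y = noG x (trans (closed _ _ x~y) a)
    partialIso zero alive closed size | suc _ = ⊥-elim (n≮0 size)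
    partialIso (suc fuel) alive closed size | suc _ with anchor alive (subst (1 ≤_) (sym c) (s≤s z≤n))
    ... | x₀ , x₀-alive , shape = Extension.extend alive (inG x₀) P′ (ClassStep.classMatch alive closed x₀ x₀-alive P′ shape)
      where
      smaller : count (λ x → (alive ∖class inG x₀) (inG x)) ≤ fuel
      smaller = ≤-pred (≤-trans (count-< _ _ (λ x p → ∧-conicalˡ _ _ p) x₀
                                         (trans (cong (λ t → alive (inG x₀) ∧ not t) (~-refl (inG x₀))) (∧-zeroʳ _)) x₀-alive)
                                 (subst (_≤ suc fuel) (sym c) size))
      P′ : PartialIso (alive ∖class inG x₀)
      P′ = partialIso fuel (alive ∖class inG x₀) (∖class-closed alive (inG x₀) closed) smaller

    isomorphic : Isomorphic G H
    isomorphic = mk↔ₛ′ f h (λ y → f∘h y refl) (λ x → h∘f x refl) , λ x x′ → f-adj x x′ refl refl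
      where open PartialIso (partialIso (n G) (λ _ → true) (λ _ _ _ → refl) (count≤size _))

proposition2p11 : (G : Graph) → Connected G → (S : VSet G) → IsTwoCore G S →
    ∃ (λ v → InV23 G S v) →
    (∀ k → Stable G k → ∀ u v → InV23 G S u → InV23 G S v →
       eqCol (adj G) k u v ≡ true → u ≡ v) →
    CRDetermined G
proposition2p11 G connected S core (v , v∈V23) discrete H indistinguishable =
  Union.Construction.isomorphic
    (oneDegenerateOn-mono {G} nonSingleton∉V23 (oneDegenerate-outside-V23 connected core v∈V23))
  where
  stable : ∃ (ColourRefinement.IsStableAt (unionAdj G H))
  stable = ColourRefinement.stableRound (unionAdj G H)
  module Union = StableUnion G H (proj₁ stable) (proj₂ stable) (indistinguishable (proj₁ stable))
  nonSingleton∉V23 : ∀ x → 2 ≤ Union.classSize (Union.inG x) → ¬ InV23 G S x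
  nonSingleton∉V23 x two≤ x∈V23 =
    <⇒≱ (s≤s (s≤s z≤n)) (subst (2 ≤_) (Union.TwoCoreColours.V23-singleton S core discrete x x∈V23) two≤)
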